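{- For every integer base $p\ge2$, $\Sigma_2\text{ - }\mathbf{BA}_p=\mathbf{BA}_p$.
   Context: Büchi arithmetic of base $p$ is the first-order theory of $\langle\mathbb{N},0,1,+,V_p\rangle$, where $V_p(a,b)$ holds iff $a$ is the largest power of $p$ dividing $b$ (i.e. $a=p^k$, $a\mid b$, $pa\nmid b$), and $V_p(a,0)$ never holds. $\Sigma_i\text{ - }\mathbf{BA}_p$ is the family of sets $\{m\in\mathbb{N}:\Phi(m)\text{ holds}\}$ for $\Sigma_i$-formulas $\Phi(x)$ (prenex, at most $i$ alternating quantifier blocks beginning with $\exists$) of Büchi arithmetic of base $p$; $\mathbf{BA}_p=\bigcup_{i\ge1}\Sigma_i\text{ - }\mathbf{BA}_p$. -}

module Defs where

open import Data.Nat using (ℕ; zero; suc; _+_; _*_; _^_)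
open import Data.Nat.Divisibility using (_∣_)
open import Data.Fin using (Fin)
open import Data.Vec using (Vec; lookup; _++_; _∷_; [])
open import Data.Product using (Σ; _×_; ∃)
open import Data.Sum using (_⊎_)
open import Relation.Nullary using (¬_)
open import Relation.Binary.PropositionalEquality using (_≡_; _≢_)

V : ℕ → ℕ → ℕ → Set
V p a b = b ≢ 0 × (Σ ℕ λ k → a ≡ p ^ k) × a ∣ b × ¬ (p * a ∣ b)

data Term (n : ℕ) : Set where
  var  : Fin n → Term n
  zer  : Term n
  one  : Term n
  plus : Term n → Term n → Term n

data QF (n : ℕ) : Set where
  eq   : Term n → Term n → QF n
  vp   : Term n → Term n → QF n
  neg  : QF n → QF n
  conj : QF n → QF n → QF n
  disj : QF n → QF n → QF n

-- A block quantifies k ≥ 0 variables at once (k = 0 allowed, so that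
-- "at most i alternating blocks" is captured).  The new variables are the
-- first k de Bruijn indices.
data Sig : ℕ → ℕ → Set
data Pi  : ℕ → ℕ → Set
data Sig where
  qfS : ∀ {n} → QF n → Sig 0 n
  ex  : ∀ {i n} (k : ℕ) → Pi i (k + n) → Sig (suc i) n
data Pi where
  qfP : ∀ {n} → QF n → Pi 0 n
  all : ∀ {i n} (k : ℕ) → Sig i (k + n) → Pi (suc i) n

evalT : ∀ {n} → Vec ℕ n → Term n → ℕ
evalT ρ (var x)    = lookup ρ x
evalT ρ zer        = 0
evalT ρ one        = 1
evalT ρ (plus s t) = evalT ρ s + evalT ρ t

SatQF : ∀ {n} → ℕ → Vec ℕ n → QF n → Set
SatQF p ρ (eq s t)   = evalT ρ s ≡ evalT ρ t
SatQF p ρ (vp s t)   = V p (evalT ρ s) (evalT ρ t)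
SatQF p ρ (neg φ)    = ¬ SatQF p ρ φ
SatQF p ρ (conj φ ψ) = SatQF p ρ φ × SatQF p ρ ψ
SatQF p ρ (disj φ ψ) = SatQF p ρ φ ⊎ SatQF p ρ ψ

SatS : ∀ {i n} → ℕ → Vec ℕ n → Sig i n → Set
SatP : ∀ {i n} → ℕ → Vec ℕ n → Pi i n → Set
SatS p ρ (qfS φ)  = SatQF p ρ φ
SatS p ρ (ex k φ) = Σ (Vec ℕ k) λ xs → SatP p (xs ++ ρ) φ
SatP p ρ (qfP φ)  = SatQF p ρ φ
SatP p ρ (all k φ) = (xs : Vec ℕ k) → SatS p (xs ++ ρ) φ

DefSet : ∀ {i} → ℕ → Sig i 1 → ℕ → Set
DefSet p φ m = SatS p (m ∷ []) φ

module Submission where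

-- A formula of Büchi arithmetic defines a p-automatic relation: a finite automaton reading
-- the base-p digits of its free variables, least significant first, accepts exactly the
-- tuples satisfying it.  The atoms x = y, x + y = z, x = 1 and V_p(x, y) are recognised by
-- small explicit automata, connectives by complement and product, and ∃ by a subset
-- construction (a state is accepting when some continuation of the projected track alone
-- leads to acceptance).
--
-- Conversely, a relation recognised by an automaton with states r is Σ₂: guess, for every
-- state r, the number X_r whose k-th digit is 1 iff the run is in state r after k digits,
-- together with a bound L = p^K on the inputs; then check, for every power a = p^k ≤ L, that
-- the k-th digits of the X_r, extracted with the help of V_p, follow the transition function,
-- and that the state reached at a = L is accepting.  Only a and the auxiliary variables used
-- to read digits are quantified universally, so the resulting formula is ∃∀.

open import Defs
open import Data.Bool using (Bool; true; false; _∧_; _∨_; not; if_then_else_)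
import Data.Bool as Bool
open import Data.Empty using (⊥; ⊥-elim)
open import Data.Fin as Fin
  using (Fin; zero; suc; toℕ; fromℕ<; combine; remQuot; _↑ˡ_; _↑ʳ_; splitAt; funToFin; finToFun)
open import Data.Fin.Properties
  using (toℕ<n; toℕ-fromℕ<; remQuot-combine; splitAt-↑ˡ; splitAt-↑ʳ; finToFun-funToFin)
open import Data.Nat
  using (ℕ; zero; suc; _+_; _*_; _∸_; _^_; _≤_; _<_; z≤n; s≤s; ≢-nonZero; _≤?_; _≟_)
open import Data.Nat.Divisibility
open import Data.Nat.DivMod
open import Data.Nat.Properties hiding (_≟_; _≤?_)
open import Data.Nat.Tactic.RingSolver using (solve-∀)
open import Data.Product using (Σ; _×_; _,_; proj₁; proj₂)
open import Data.Sum using (_⊎_; inj₁; inj₂; [_,_]′)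
open import Data.Vec using (Vec; []; _∷_; lookup; map; tabulate; replicate; _++_; sum)
open import Data.Vec.Properties
  using ( lookup-map; lookup∘tabulate; tabulate∘lookup; tabulate-cong; tabulate-∘; map-∘
        ; lookup-++ˡ; lookup-++ʳ; ≡-dec)
open import Function.Bundles using (_⇔_; mk⇔)
open import Relation.Nullary using (¬_; Dec; yes; no)
open import Relation.Nullary.Decidable using (⌊_⌋)
open import Relation.Binary.PropositionalEquality

infix 2 _⟺_
_⟺_ : Set → Set → Set
A ⟺ B = (A → B) × (B → A)

⟺-refl : ∀ {A} → A ⟺ A
⟺-refl = (λ a → a) , (λ a → a)

⟺-sym : ∀ {A B} → A ⟺ B → B ⟺ A
⟺-sym (f , g) = g , f

⟺-trans : ∀ {A B C} → A ⟺ B → B ⟺ C → A ⟺ C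
⟺-trans (f , g) (f′ , g′) = (λ a → f′ (f a)) , (λ c → g (g′ c))

≡-⟺ : ∀ {A : Set} {a a′ b b′ : A} → a ≡ a′ → b ≡ b′ → a ≡ b ⟺ a′ ≡ b′
≡-⟺ refl refl = ⟺-refl

×-⟺ : ∀ {A B C D} → A ⟺ C → B ⟺ D → (A × B) ⟺ (C × D)
×-⟺ (f , g) (f′ , g′) = Data.Product.map f f′ , Data.Product.map g g′

⊎-⟺ : ∀ {A B C D} → A ⟺ C → B ⟺ D → (A ⊎ B) ⟺ (C ⊎ D)
⊎-⟺ (f , g) (f′ , g′) = Data.Sum.map f f′ , Data.Sum.map g g′

zeros : ∀ n → Vec ℕ n
zeros n = replicate n 0

lookup-zeros : ∀ {n} (i : Fin n) → lookup (zeros n) i ≡ 0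
lookup-zeros zero = refl
lookup-zeros (suc i) = lookup-zeros i

≡true-ext : ∀ {a b : Bool} → (a ≡ true ⟺ b ≡ true) → a ≡ b
≡true-ext {false} {false} _ = refl
≡true-ext {false} {true} (_ , from) = from refl
≡true-ext {true} {false} (to , _) = sym (to refl)
≡true-ext {true} {true} _ = refl

∧≡true : ∀ {a b : Bool} → a ∧ b ≡ true ⟺ (a ≡ true × b ≡ true)
∧≡true {true} {true} = (λ _ → refl , refl) , (λ _ → refl)
∧≡true {true} {false} = (λ ()) , (λ ())
∧≡true {false} {b} = (λ ()) , (λ ())

∨≡true : ∀ {a b : Bool} → a ∨ b ≡ true ⟺ (a ≡ true ⊎ b ≡ true)
∨≡true {true} {b} = (λ _ → inj₁ refl) , (λ _ → refl)
∨≡true {false} {true} = (λ _ → inj₂ refl) , (λ _ → refl)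
∨≡true {false} {false} = (λ ()) , λ { (inj₁ ()) ; (inj₂ ()) }

not≡true : ∀ {a : Bool} → not a ≡ true ⟺ ¬ (a ≡ true)
not≡true {true} = (λ ()) , (λ h → ⊥-elim (h refl))
not≡true {false} = (λ _ ()) , (λ _ → refl)

lookup-ext : ∀ {A : Set} {m} {u v : Vec A m} → (∀ i → lookup u i ≡ lookup v i) → u ≡ v
lookup-ext {u = u} {v} e = trans (sym (tabulate∘lookup u)) (trans (tabulate-cong e) (tabulate∘lookup v))

select : ∀ {m n} → (Fin m → Fin n) → Vec ℕ n → Vec ℕ m
select g ρ = tabulate (λ i → lookup ρ (g i))

select-map : ∀ {m n} (g : Fin m → Fin n) (f : ℕ → ℕ) ρ → select g (map f ρ) ≡ map f (select g ρ)
select-map g f ρ = trans (tabulate-cong (λ i → lookup-map (g i) f ρ)) (tabulate-∘ f _)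

select-zeros : ∀ {m n} (g : Fin m → Fin n) → select g (zeros n) ≡ zeros m
select-zeros {zero} g = refl
select-zeros {suc m} g = cong₂ _∷_ (lookup-zeros (g zero)) (select-zeros (λ i → g (suc i)))

anyFin : ∀ m → (Fin m → Bool) → Bool
anyFin zero f = false
anyFin (suc m) f = f zero ∨ anyFin m (λ i → f (suc i))

anyFin≡true : ∀ m (f : Fin m → Bool) → anyFin m f ≡ true ⟺ Σ (Fin m) λ i → f i ≡ true
anyFin≡true zero f = (λ ()) , λ { (() , _) }
anyFin≡true (suc m) f = ⟺-trans ∨≡true
  ((λ { (inj₁ e) → zero , e ; (inj₂ e) → let (i , e′) = proj₁ (anyFin≡true m _) e in suc i , e′ }) ,
   (λ { (zero , e) → inj₁ e ; (suc i , e) → inj₂ (proj₂ (anyFin≡true m _) (i , e)) }))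

_==_ : ∀ {m} → Fin m → Fin m → Bool
a == b = ⌊ a Fin.≟ b ⌋

==≡true : ∀ {m} (a b : Fin m) → a == b ≡ true ⟺ a ≡ b
==≡true a b with a Fin.≟ b
... | yes e = (λ _ → e) , (λ _ → refl)
... | no ne = (λ ()) , (λ e → ⊥-elim (ne e))

fromBool : Bool → Fin 2
fromBool b = if b then suc zero else zero

toBool : Fin 2 → Bool
toBool zero = false
toBool (suc _) = true

toBool-fromBool : ∀ b → toBool (fromBool b) ≡ b
toBool-fromBool false = refl
toBool-fromBool true = refl

encode : ∀ {S} → Vec Bool S → Fin (2 ^ S)
encode v = funToFin (λ r → fromBool (lookup v r))

decode : ∀ {S} → Fin (2 ^ S) → Vec Bool S
decode i = tabulate (λ r → toBool (finToFun i r))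

decode-encode : ∀ {S} (v : Vec Bool S) → decode (encode v) ≡ v
decode-encode v =
  trans (tabulate-cong (λ r → trans (cong toBool (finToFun-funToFin _ r)) (toBool-fromBool (lookup v r))))
        (tabulate∘lookup v)

_⊆ᵇ_ : ∀ {m} → Vec Bool m → Vec Bool m → Set
v ⊆ᵇ w = ∀ r → lookup v r ≡ true → lookup w r ≡ true

size : ∀ {m} → Vec Bool m → ℕ
size [] = 0
size (true ∷ v) = suc (size v)
size (false ∷ v) = size v

size≤ : ∀ {m} (v : Vec Bool m) → size v ≤ m
size≤ [] = z≤n
size≤ (true ∷ v) = s≤s (size≤ v)
size≤ (false ∷ v) = m≤n⇒m≤1+n (size≤ v)

⊆ᵇ⇒size≤ : ∀ {m} (v w : Vec Bool m) → v ⊆ᵇ w → size v ≤ size w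
⊆ᵇ⇒size≤ [] [] _ = z≤n
⊆ᵇ⇒size≤ (true ∷ v) (true ∷ w) h = s≤s (⊆ᵇ⇒size≤ v w (λ r → h (suc r)))
⊆ᵇ⇒size≤ (true ∷ v) (false ∷ w) h with () <- h zero refl
⊆ᵇ⇒size≤ (false ∷ v) (true ∷ w) h = m≤n⇒m≤1+n (⊆ᵇ⇒size≤ v w (λ r → h (suc r)))
⊆ᵇ⇒size≤ (false ∷ v) (false ∷ w) h = ⊆ᵇ⇒size≤ v w (λ r → h (suc r))

⊂ᵇ⇒size< : ∀ {m} (v w : Vec Bool m) → v ⊆ᵇ w → v ≢ w → size v < size w
⊂ᵇ⇒size< [] [] _ v≢w = ⊥-elim (v≢w refl)
⊂ᵇ⇒size< (true ∷ v) (true ∷ w) h v≢w =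
  s≤s (⊂ᵇ⇒size< v w (λ r → h (suc r)) (λ e → v≢w (cong (true ∷_) e)))
⊂ᵇ⇒size< (true ∷ v) (false ∷ w) h _ with () <- h zero refl
⊂ᵇ⇒size< (false ∷ v) (true ∷ w) h _ = s≤s (⊆ᵇ⇒size≤ v w (λ r → h (suc r)))
⊂ᵇ⇒size< (false ∷ v) (false ∷ w) h v≢w =
  ⊂ᵇ⇒size< v w (λ r → h (suc r)) (λ e → v≢w (cong (false ∷_) e))

module _ (q : ℕ) where

  p : ℕ
  p = suc (suc q)

  1<p : 1 < p
  1<p = s≤s (s≤s z≤n)

  m≡m%p+p*[m/p] : ∀ m → m ≡ m % p + p * (m / p)
  m≡m%p+p*[m/p] m = trans (m≡m%n+[m/n]*n m p) (cong (m % p +_) (*-comm (m / p) p))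

  [d+p*m]%p≡d : ∀ d m → d < p → (d + p * m) % p ≡ d
  [d+p*m]%p≡d d m d<p =
    trans (cong (λ t → (d + t) % p) (*-comm p m)) (trans ([m+kn]%n≡m%n d m p) (m<n⇒m%n≡m d<p))

  [d+p*m]/p≡m : ∀ d m → d < p → (d + p * m) / p ≡ m
  [d+p*m]/p≡m d m d<p = sym (*-cancelˡ-≡ m ((d + p * m) / p) p (+-cancelˡ-≡ d _ _ split))
    where
    split : d + p * m ≡ d + p * ((d + p * m) / p)
    split = trans (m≡m%p+p*[m/p] (d + p * m)) (cong (λ t → t + p * ((d + p * m) / p)) ([d+p*m]%p≡d d m d<p))

  d+p*m-injective : ∀ {d e m n} → d < p → e < p → d + p * m ≡ e + p * n → d ≡ e × m ≡ n
  d+p*m-injective {d} {e} {m} {n} d<p e<p h =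
    trans (sym ([d+p*m]%p≡d d m d<p)) (trans (cong (_% p) h) ([d+p*m]%p≡d e n e<p)) ,
    trans (sym ([d+p*m]/p≡m d m d<p)) (trans (cong (_/ p) h) ([d+p*m]/p≡m e n e<p))

  d+p*m<p*n : ∀ {d m n} → d < p → m < n → d + p * m < p * n
  d+p*m<p*n {d} {m} {n} d<p m<n =
    ≤-trans (+-monoˡ-< (p * m) d<p) (≤-trans (≤-reflexive (sym (*-suc p m))) (*-monoʳ-≤ p m<n))

  m%p≡0⇒m≡p*[m/p] : ∀ m → m % p ≡ 0 → m ≡ p * (m / p)
  m%p≡0⇒m≡p*[m/p] m h = trans (m≡m%p+p*[m/p] m) (cong (λ t → t + p * (m / p)) h)

  m/p<p^k : ∀ {m k} → m < p ^ suc k → m / p < p ^ k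
  m/p<p^k {m} {k} m< = m<n*o⇒m/o<n (subst (m <_) (*-comm p (p ^ k)) m<)

  p^-mono-< : ∀ {k j} → k < j → p ^ k < p ^ j
  p^-mono-< = ^-monoʳ-< p 1<p

  p^-mono-≤ : ∀ {k j} → k ≤ j → p ^ k ≤ p ^ j
  p^-mono-≤ = ^-monoʳ-≤ p

  p^-cancel-≤ : ∀ {k j} → p ^ k ≤ p ^ j → k ≤ j
  p^-cancel-≤ {k} {j} le with k ≤? j
  ... | yes k≤j = k≤j
  ... | no k≰j = ⊥-elim (<⇒≱ (p^-mono-< (≰⇒> k≰j)) le)

  p^-injective : ∀ {k j} → p ^ k ≡ p ^ j → k ≡ j
  p^-injective e = ≤-antisym (p^-cancel-≤ (≤-reflexive e)) (p^-cancel-≤ (≤-reflexive (sym e)))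

  p^-mono-∣ : ∀ {k j} → k ≤ j → p ^ k ∣ p ^ j
  p^-mono-∣ {k} {j} k≤j =
    divides (p ^ (j ∸ k)) (trans (cong (p ^_) (sym (m∸n+n≡m k≤j))) (^-distribˡ-+-* p (j ∸ k) k))

  p^suc%p≡0 : ∀ k → p ^ suc k % p ≡ 0
  p^suc%p≡0 k = n∣m⇒m%n≡0 (p ^ suc k) p (divides (p ^ k) (*-comm p (p ^ k)))

  n<p^n : ∀ n → n < p ^ n
  n<p^n zero = s≤s z≤n
  n<p^n (suc n) = ≤-trans (s≤s (n<p^n n)) (1+m≤p*m (p ^ n) (m^n>0 p n))
    where
    1+m≤p*m : ∀ m → 0 < m → suc m ≤ p * m
    1+m≤p*m (suc m) _ = s≤s (≤-trans (≤-reflexive (+-comm 1 m)) (+-monoʳ-≤ m (s≤s z≤n)))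

  cancel-p^ : ∀ k {m n} → m * p ^ k ≡ n * p ^ k → m ≡ n
  cancel-p^ k e = *-cancelʳ-≡ _ _ (p ^ k) {{m^n≢0 p k}} e

  digit : ℕ → ℕ → ℕ
  digit m zero = m % p
  digit m (suc k) = digit (m / p) k

  upper : ℕ → ℕ → ℕ
  upper m zero = m / p
  upper m (suc k) = upper (m / p) k

  lower : ℕ → ℕ → ℕ
  lower m zero = 0
  lower m (suc k) = m % p + p * lower (m / p) k

  digit<p : ∀ m k → digit m k < p
  digit<p m zero = m%n<n m p
  digit<p m (suc k) = digit<p (m / p) k

  lower<p^k : ∀ m k → lower m k < p ^ k
  lower<p^k m zero = s≤s z≤n
  lower<p^k m (suc k) = d+p*m<p*n (m%n<n m p) (lower<p^k (m / p) k)

  digit-decomposition : ∀ m k → m ≡ p ^ suc k * upper m k + digit m k * p ^ k + lower m k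
  digit-decomposition m zero = trans (m≡m%p+p*[m/p] m) (ring (m % p) (m / p) p)
    where
    ring : ∀ d h P → d + P * h ≡ P * 1 * h + d * 1 + 0
    ring = solve-∀
  digit-decomposition m (suc k) =
    trans (m≡m%p+p*[m/p] m)
      (trans (cong (λ t → m % p + p * t) (digit-decomposition (m / p) k))
        (ring (m % p) (upper (m / p) k) (digit (m / p) k) (lower (m / p) k) p (p ^ k)))
    where
    ring : ∀ d h g l P Q → d + P * (P * Q * h + g * Q + l) ≡ P * (P * Q) * h + g * (P * Q) + (d + P * l)
    ring = solve-∀

  digit-unique : ∀ k h v l → v < p → l < p ^ k → digit (p ^ suc k * h + v * p ^ k + l) k ≡ v
  digit-unique zero h v zero v<p _ = trans (cong (_% p) (ring h v p)) ([d+p*m]%p≡d v h v<p)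
    where
    ring : ∀ h v P → P * 1 * h + v * 1 + 0 ≡ v + P * h
    ring = solve-∀
  digit-unique zero h v (suc l) v<p (s≤s ())
  digit-unique (suc k) h v l v<p l< =
    trans (cong (λ t → digit (t / p) k)
            (trans (cong (p ^ suc (suc k) * h + v * p ^ suc k +_) (m≡m%p+p*[m/p] l))
              (ring h v (l % p) (l / p) p (p ^ k))))
      (trans (cong (λ t → digit t k) ([d+p*m]/p≡m (l % p) _ (m%n<n l p)))
        (digit-unique k h v (l / p) v<p (m/p<p^k {l} {k} l<)))
    where
    ring : ∀ h v d w P Q → P * (P * Q) * h + v * (P * Q) + (d + P * w) ≡ d + P * (P * Q * h + v * Q + w)
    ring = solve-∀

  fromDigits : (ℕ → ℕ) → ℕ → ℕ
  fromDigits f zero = 0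
  fromDigits f (suc n) = f 0 + p * fromDigits (λ k → f (suc k)) n

  digit-fromDigits : ∀ f n k → (∀ j → f j < p) → k < n → digit (fromDigits f n) k ≡ f k
  digit-fromDigits f (suc n) zero f<p _ = [d+p*m]%p≡d (f 0) (fromDigits (λ k → f (suc k)) n) (f<p 0)
  digit-fromDigits f (suc n) (suc k) f<p (s≤s k<n) =
    trans (cong (λ m → digit m k) ([d+p*m]/p≡m (f 0) (fromDigits (λ j → f (suc j)) n) (f<p 0)))
      (digit-fromDigits (λ j → f (suc j)) n k (λ j → f<p (suc j)) k<n)

  V-power : ∀ {a b} → V p a b → Σ ℕ λ k → a ≡ p ^ k
  V-power (_ , power , _) = power

  ¬V-0 : ∀ {a} → ¬ V p a 0
  ¬V-0 (b≢0 , _) = b≢0 refl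

  V-p^k-p^k : ∀ k → V p (p ^ k) (p ^ k)
  V-p^k-p^k k = (λ e → <⇒≢ (m^n>0 p k) (sym e)) , (k , refl) , ∣-refl ,
    λ h → <⇒≱ (p^-mono-< (n<1+n k)) (∣⇒≤ {{m^n≢0 p k}} h)

  V-*p : ∀ {a b} → V p a b → V p (p * a) (p * b)
  V-*p (b≢0 , (k , a≡) , a∣b , p*a∤b) =
    (λ e → b≢0 (*-cancelˡ-≡ _ 0 p (trans e (sym (*-zeroʳ p))))) ,
    (suc k , cong (p *_) a≡) , *-monoʳ-∣ p a∣b , λ h → p*a∤b (*-cancelˡ-∣ p h)

  p*m≢1 : ∀ m → p * m ≢ 1
  p*m≢1 zero e = 0≢1+n (trans (sym (*-zeroʳ p)) e)
  p*m≢1 (suc m) e = <⇒≢ (≤-trans 1<p (m≤m*n p (suc m))) (sym e)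

  V-/p : ∀ {a b} → V p (p * a) (p * b) → V p a b
  V-/p {a} {b} (pb≢0 , (k , pa≡) , pa∣pb , ppa∤pb) =
    (λ e → pb≢0 (trans (cong (p *_) e) (*-zeroʳ p))) , power k pa≡ , *-cancelˡ-∣ p pa∣pb ,
    λ h → ppa∤pb (*-monoʳ-∣ p h)
    where
    power : ∀ k → p * a ≡ p ^ k → Σ ℕ λ j → a ≡ p ^ j
    power zero e = ⊥-elim (p*m≢1 a e)
    power (suc j) e = j , *-cancelˡ-≡ a (p ^ j) p e

  V-*p^ : ∀ j {a b} → V p a b → V p (p ^ j * a) (p ^ j * b)
  V-*p^ zero {a} {b} v = subst₂ (V p) (sym (+-identityʳ a)) (sym (+-identityʳ b)) v
  V-*p^ (suc j) {a} {b} v =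
    subst₂ (V p) (sym (*-assoc p (p ^ j) a)) (sym (*-assoc p (p ^ j) b)) (V-*p (V-*p^ j v))

  V-exists : ∀ m → m ≢ 0 → Σ ℕ λ c → V p c m
  V-exists m m≢0 = bounded m m m≢0 ≤-refl
    where
    bounded : ∀ fuel m → m ≢ 0 → m ≤ fuel → Σ ℕ λ c → V p c m
    bounded fuel m m≢0 m≤fuel with m % p ≟ 0
    ... | no m%p≢0 = 1 , m≢0 , (0 , refl) , divides m (sym (*-identityʳ m)) ,
                     λ h → m%p≢0 (n∣m⇒m%n≡0 m p (subst (_∣ m) (*-identityʳ p) h))
    bounded zero m m≢0 m≤0 | yes _ = ⊥-elim (m≢0 (n≤0⇒n≡0 m≤0))
    bounded (suc fuel) m m≢0 m≤fuel | yes m%p≡0 =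
      let m≡ = m%p≡0⇒m≡p*[m/p] m m%p≡0
          m/p≢0 = λ e → m≢0 (trans m≡ (trans (cong (p *_) e) (*-zeroʳ p)))
          (c , v) = bounded fuel (m / p) m/p≢0 (≤-pred (≤-trans (m/n<m m p {{≢-nonZero m≢0}} 1<p) m≤fuel))
      in p * c , subst (V p (p * c)) (sym m≡) (V-*p v)

  V-≥p^⇒p^∣ : ∀ j {c m} → V p c m → p ^ j ≤ c → p ^ j ∣ m
  V-≥p^⇒p^∣ j {c} {m} (_ , (k , c≡) , c∣m , _) le =
    ∣-trans (p^-mono-∣ (p^-cancel-≤ {j} {k} (subst (p ^ j ≤_) c≡ le))) (subst (_∣ m) c≡ c∣m)

  p^*-V-≥p^ : ∀ j m → m ≢ 0 → Σ ℕ λ c → V p c (p ^ j * m) × p ^ j ≤ c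
  p^*-V-≥p^ j m m≢0 =
    let (c , v) = V-exists m m≢0
        (k , c≡) = V-power v
    in p ^ j * c , V-*p^ j v ,
       m≤m*n (p ^ j) c {{≢-nonZero λ c≡0 → <⇒≢ (m^n>0 p k) (sym (trans (sym c≡) c≡0))}}

  V-step-0-0 : ∀ {x y} → x % p ≡ 0 → y % p ≡ 0 → V p x y ⟺ V p (x / p) (y / p)
  V-step-0-0 {x} {y} x%p≡0 y%p≡0 =
    (λ v → V-/p (subst₂ (V p) x≡ y≡ v)) , (λ v → subst₂ (V p) (sym x≡) (sym y≡) (V-*p v))
    where
    x≡ = m%p≡0⇒m≡p*[m/p] x x%p≡0
    y≡ = m%p≡0⇒m≡p*[m/p] y y%p≡0

  ≡1-step : ∀ {x} → x % p ≡ 1 → x ≡ 1 ⟺ x / p ≡ 0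
  ≡1-step {x} x%p≡1 =
    (λ x≡1 → trans (cong (_/ p) x≡1) (m<n⇒m/n≡0 1<p)) ,
    (λ x/p≡0 → trans (m≡m%p+p*[m/p] x) (trans (cong₂ (λ a b → a + p * b) x%p≡1 x/p≡0) (cong suc (*-zeroʳ p))))

  V-step-1-≢0 : ∀ {x y} → x % p ≡ 1 → y % p ≢ 0 → V p x y ⟺ x / p ≡ 0
  V-step-1-≢0 {x} {y} x%p≡1 y%p≢0 = ⟺-trans (to , from) (≡1-step x%p≡1)
    where
    to : V p x y → x ≡ 1
    to (_ , (zero , x≡1) , _) = x≡1
    to (_ , (suc k , x≡) , _) with () <- trans (sym (trans (cong (_% p) x≡) (p^suc%p≡0 k))) x%p≡1
    from : x ≡ 1 → V p x y
    from refl = (λ y≡0 → y%p≢0 (cong (_% p) y≡0)) , (0 , refl) , divides y (sym (*-identityʳ y)) ,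
                λ h → y%p≢0 (n∣m⇒m%n≡0 y p (subst (_∣ y) (*-identityʳ p) h))

  ¬V-step-0-≢0 : ∀ {x y} → x % p ≡ 0 → y % p ≢ 0 → ¬ V p x y
  ¬V-step-0-≢0 x%p≡0 y%p≢0 (_ , (zero , x≡1) , _) with () <- trans (sym x%p≡0) (cong (_% p) x≡1)
  ¬V-step-0-≢0 {x} {y} x%p≡0 y%p≢0 (_ , (suc k , x≡) , x∣y , _) =
    y%p≢0 (n∣m⇒m%n≡0 y p (∣-trans (divides (p ^ k) (*-comm p (p ^ k))) (subst (_∣ y) x≡ x∣y)))

  ¬V-step-1-0 : ∀ {x y} → x % p ≡ 1 → y % p ≡ 0 → ¬ V p x y
  ¬V-step-1-0 {x} {y} x%p≡1 y%p≡0 (_ , (zero , x≡1) , _ , p*x∤y) =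
    p*x∤y (subst (λ t → p * t ∣ y) (sym x≡1) (subst (_∣ y) (sym (*-identityʳ p)) (m%n≡0⇒n∣m y p y%p≡0)))
  ¬V-step-1-0 x%p≡1 y%p≡0 (_ , (suc k , x≡) , _) with () <- trans (sym (trans (cong (_% p) x≡) (p^suc%p≡0 k))) x%p≡1

  ¬V-step-≥2 : ∀ {x y} → 2 ≤ x % p → ¬ V p x y
  ¬V-step-≥2 le (_ , (zero , x≡1) , _) with s≤s () <- subst (2 ≤_) (cong (_% p) x≡1) le
  ¬V-step-≥2 le (_ , (suc k , x≡) , _) with () <- subst (2 ≤_) (trans (cong (_% p) x≡) (p^suc%p≡0 k)) le

  ≡0-step : ∀ {x} → x % p ≡ 0 → x ≡ 0 ⟺ x / p ≡ 0
  ≡0-step {x} x%p≡0 = cong (_/ p) , λ e → trans (m%p≡0⇒m≡p*[m/p] x x%p≡0) (trans (cong (p *_) e) (*-zeroʳ p))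

  -- Automata reading base-p digits, least significant first

  lowDigits highParts : ∀ {n} → Vec ℕ n → Vec ℕ n
  lowDigits = map (_% p)
  highParts = map (_/ p)

  lowDigits-zeros : ∀ n → lowDigits (zeros n) ≡ zeros n
  lowDigits-zeros zero = refl
  lowDigits-zeros (suc n) = cong (0 ∷_) (lowDigits-zeros n)

  highParts-zeros : ∀ n → highParts (zeros n) ≡ zeros n
  highParts-zeros zero = refl
  highParts-zeros (suc n) = cong (0 ∷_) (highParts-zeros n)

  infix 4 _<ᵥ_
  _<ᵥ_ : ∀ {n} → Vec ℕ n → ℕ → Set
  ρ <ᵥ B = ∀ i → lookup ρ i < B

  <ᵥ1⇒zeros : ∀ {n} (ρ : Vec ℕ n) → ρ <ᵥ 1 → ρ ≡ zeros n
  <ᵥ1⇒zeros [] _ = refl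
  <ᵥ1⇒zeros (x ∷ ρ) h with h zero
  ... | s≤s z≤n = cong (0 ∷_) (<ᵥ1⇒zeros ρ (λ i → h (suc i)))

  highParts-<ᵥ : ∀ {n} (ρ : Vec ℕ n) L → ρ <ᵥ p ^ suc L → highParts ρ <ᵥ p ^ L
  highParts-<ᵥ ρ L h i = subst (_< p ^ L) (sym (lookup-map i (_/ p) ρ)) (m/p<p^k {lookup ρ i} {L} (h i))

  lookup≤sum : ∀ {n} (ρ : Vec ℕ n) i → lookup ρ i ≤ sum ρ
  lookup≤sum (x ∷ ρ) zero = m≤m+n x (sum ρ)
  lookup≤sum (x ∷ ρ) (suc i) = ≤-trans (lookup≤sum ρ i) (m≤n+m (sum ρ) x)

  <ᵥp^sum : ∀ {n} (ρ : Vec ℕ n) → ρ <ᵥ p ^ sum ρ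
  <ᵥp^sum ρ i = ≤-<-trans (lookup≤sum ρ i) (n<p^n (sum ρ))

  record DFA (n : ℕ) : Set where
    field
      states : ℕ
      start : Fin states
      δ : Fin states → Vec ℕ n → Fin states
      accept : Fin states → Bool

  open DFA public

  run : ∀ {n} (M : DFA n) → Fin (states M) → Vec ℕ n → ℕ → Fin (states M)
  run M r ρ zero = r
  run M r ρ (suc L) = run M (δ M r (lowDigits ρ)) (highParts ρ) L

  -- Makes the verdict independent of the number of leading zero digits read.
  ZeroStable : ∀ {n} → DFA n → Set
  ZeroStable {n} M = ∀ r → accept M (δ M r (zeros n)) ≡ accept M r

  Recognises : ∀ {n} → DFA n → (Vec ℕ n → Set) → Set
  Recognises M R = ∀ L ρ → ρ <ᵥ p ^ L → (accept M (run M (start M) ρ L) ≡ true ⟺ R ρ)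

  Automatic : ∀ n → (Vec ℕ n → Set) → Set
  Automatic n R = Σ (DFA n) λ M → ZeroStable M × Recognises M R

  module _ {n} (M : DFA n) (P : Fin (states M) → Vec ℕ n → Set)
           (base : ∀ r → accept M r ≡ true ⟺ P r (zeros n))
           (step : ∀ r ρ → P r ρ ⟺ P (δ M r (lowDigits ρ)) (highParts ρ)) where

    run-invariant : ∀ L r ρ → ρ <ᵥ p ^ L → accept M (run M r ρ L) ≡ true ⟺ P r ρ
    run-invariant zero r ρ h rewrite <ᵥ1⇒zeros ρ h = base r
    run-invariant (suc L) r ρ h =
      ⟺-trans (run-invariant L (δ M r (lowDigits ρ)) (highParts ρ) (highParts-<ᵥ ρ L h)) (⟺-sym (step r ρ))

    invariant-zeroStable : ZeroStable M
    invariant-zeroStable r = ≡true-ext (⟺-trans (base _) (⟺-trans read-zeros (⟺-sym (base r))))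
      where
      read-zeros : P (δ M r (zeros n)) (zeros n) ⟺ P r (zeros n)
      read-zeros = subst₂ (λ c d → P (δ M r c) d ⟺ P r (zeros n)) (lowDigits-zeros n) (highParts-zeros n)
                     (⟺-sym (step r (zeros n)))

    automatic-by-invariant : Automatic n (P (start M))
    automatic-by-invariant = M , invariant-zeroStable , λ L ρ h → run-invariant L (start M) ρ h

  Automatic-resp : ∀ {n R R′} → Automatic n R → (∀ ρ → R ρ ⟺ R′ ρ) → Automatic n R′
  Automatic-resp (M , zs , rec) e = M , zs , λ L ρ h → ⟺-trans (rec L ρ h) (e ρ)

  Automatic-dec : ∀ {n R} → Automatic n R → ∀ ρ → Dec (R ρ)
  Automatic-dec (M , _ , rec) ρ with accept M (run M (start M) ρ (sum ρ)) in acc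
  ... | true = yes (proj₁ (rec (sum ρ) ρ (<ᵥp^sum ρ)) acc)
  ... | false = no λ r → false≢true (trans (sym acc) (proj₂ (rec (sum ρ) ρ (<ᵥp^sum ρ)) r))
    where
    false≢true : false ≢ true
    false≢true ()

  complement : ∀ {n} → DFA n → DFA n
  complement M = record M { accept = λ r → not (accept M r) }

  run-complement : ∀ {n} (M : DFA n) L r ρ → run (complement M) r ρ L ≡ run M r ρ L
  run-complement M zero r ρ = refl
  run-complement M (suc L) r ρ = run-complement M L _ _

  Automatic-¬ : ∀ {n R} → Automatic n R → Automatic n (λ ρ → ¬ R ρ)
  Automatic-¬ (M , zs , rec) = complement M , (λ r → cong not (zs r)) , λ L ρ h →
    subst (λ t → (not (accept M t) ≡ true) ⟺ _) (sym (run-complement M L (start M) ρ))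
      (⟺-trans not≡true ((λ ¬a r → ¬a (proj₂ (rec L ρ h) r)) , (λ ¬r a → ¬r (proj₁ (rec L ρ h) a))))

  product : ∀ {n} → (Bool → Bool → Bool) → DFA n → DFA n → DFA n
  product f M₁ M₂ = record
    { states = states M₁ * states M₂
    ; start = combine (start M₁) (start M₂)
    ; δ = λ i c → let (r₁ , r₂) = remQuot (states M₂) i in combine (δ M₁ r₁ c) (δ M₂ r₂ c)
    ; accept = λ i → let (r₁ , r₂) = remQuot (states M₂) i in f (accept M₁ r₁) (accept M₂ r₂) }

  module _ {n} (f : Bool → Bool → Bool) (M₁ M₂ : DFA n) where

    accept-product : ∀ r₁ r₂ → accept (product f M₁ M₂) (combine r₁ r₂) ≡ f (accept M₁ r₁) (accept M₂ r₂)
    accept-product r₁ r₂ =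
      cong (λ (r₁ , r₂) → f (accept M₁ r₁) (accept M₂ r₂)) (remQuot-combine {states M₁} {states M₂} r₁ r₂)

    run-product : ∀ L r₁ r₂ ρ →
                  run (product f M₁ M₂) (combine r₁ r₂) ρ L ≡ combine (run M₁ r₁ ρ L) (run M₂ r₂ ρ L)
    run-product zero r₁ r₂ ρ = refl
    run-product (suc L) r₁ r₂ ρ =
      trans (cong (λ (r₁ , r₂) → run (product f M₁ M₂) (combine (δ M₁ r₁ c) (δ M₂ r₂ c)) (highParts ρ) L)
                  (remQuot-combine {states M₁} {states M₂} r₁ r₂))
        (run-product L _ _ (highParts ρ))
      where
      c = lowDigits ρ

    product-zeroStable : ZeroStable M₁ → ZeroStable M₂ → ZeroStable (product f M₁ M₂)
    product-zeroStable zs₁ zs₂ i = trans (accept-product _ _) (cong₂ f (zs₁ _) (zs₂ _))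

    accept-run-product : ∀ L ρ → accept (product f M₁ M₂) (run (product f M₁ M₂) (start (product f M₁ M₂)) ρ L)
                                 ≡ f (accept M₁ (run M₁ (start M₁) ρ L)) (accept M₂ (run M₂ (start M₂) ρ L))
    accept-run-product L ρ rewrite run-product L (start M₁) (start M₂) ρ = accept-product _ _

  Automatic-× : ∀ {n R₁ R₂} → Automatic n R₁ → Automatic n R₂ → Automatic n (λ ρ → R₁ ρ × R₂ ρ)
  Automatic-× (M₁ , zs₁ , rec₁) (M₂ , zs₂ , rec₂) =
    product _∧_ M₁ M₂ , product-zeroStable _∧_ M₁ M₂ zs₁ zs₂ , λ L ρ h →
      subst (λ b → b ≡ true ⟺ _) (sym (accept-run-product _∧_ M₁ M₂ L ρ))
        (⟺-trans ∧≡true (×-⟺ (rec₁ L ρ h) (rec₂ L ρ h)))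

  Automatic-⊎ : ∀ {n R₁ R₂} → Automatic n R₁ → Automatic n R₂ → Automatic n (λ ρ → R₁ ρ ⊎ R₂ ρ)
  Automatic-⊎ (M₁ , zs₁ , rec₁) (M₂ , zs₂ , rec₂) =
    product _∨_ M₁ M₂ , product-zeroStable _∨_ M₁ M₂ zs₁ zs₂ , λ L ρ h →
      subst (λ b → b ≡ true ⟺ _) (sym (accept-run-product _∨_ M₁ M₂ L ρ))
        (⟺-trans ∨≡true (⊎-⟺ (rec₁ L ρ h) (rec₂ L ρ h)))

  reindex : ∀ {m n} → (Fin m → Fin n) → DFA m → DFA n
  reindex g M = record { states = states M ; start = start M ; δ = λ r c → δ M r (select g c) ; accept = accept M }

  run-reindex : ∀ {m n} (g : Fin m → Fin n) (M : DFA m) L r ρ → run (reindex g M) r ρ L ≡ run M r (select g ρ) L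
  run-reindex g M zero r ρ = refl
  run-reindex g M (suc L) r ρ
    rewrite run-reindex g M L (δ M r (select g (lowDigits ρ))) (highParts ρ)
          | select-map g (_% p) ρ | select-map g (_/ p) ρ = refl

  Automatic-select : ∀ {m n R} (g : Fin m → Fin n) → Automatic m R → Automatic n (λ ρ → R (select g ρ))
  Automatic-select g (M , zs , rec) =
    reindex g M , (λ r → subst (λ c → accept M (δ M r c) ≡ accept M r) (sym (select-zeros g)) (zs r)) ,
    λ L ρ h → subst (λ t → (accept M t ≡ true) ⟺ _) (sym (run-reindex g M L (start M) ρ))
      (rec L (select g ρ) (λ i → subst (_< p ^ L) (sym (lookup∘tabulate _ i)) (h (g i))))

  module Acceptance {n} (M : DFA n) (zs : ZeroStable M) where

    accept-run-zeros : ∀ m r → accept M (run M r (zeros n) m) ≡ accept M r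
    accept-run-zeros zero r = refl
    accept-run-zeros (suc m) r rewrite lowDigits-zeros n | highParts-zeros n = trans (accept-run-zeros m _) (zs r)

    accept-run-+ : ∀ L m r ρ → ρ <ᵥ p ^ L → accept M (run M r ρ (L + m)) ≡ accept M (run M r ρ L)
    accept-run-+ zero m r ρ h rewrite <ᵥ1⇒zeros ρ h = accept-run-zeros m r
    accept-run-+ (suc L) m r ρ h = accept-run-+ L m _ _ (highParts-<ᵥ ρ L h)

    accept-run-length : ∀ L₁ L₂ r ρ → ρ <ᵥ p ^ L₁ → ρ <ᵥ p ^ L₂ →
                        accept M (run M r ρ L₁) ≡ accept M (run M r ρ L₂)
    accept-run-length L₁ L₂ r ρ h₁ h₂ =
      trans (sym (accept-run-+ L₁ L₂ r ρ h₁))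
        (trans (cong (λ L → accept M (run M r ρ L)) (+-comm L₁ L₂)) (accept-run-+ L₂ L₁ r ρ h₂))

    Accepts : Fin (states M) → Vec ℕ n → Set
    Accepts r ρ = accept M (run M r ρ (sum ρ)) ≡ true

    Accepts-run : ∀ L r ρ → ρ <ᵥ p ^ L → accept M (run M r ρ L) ≡ true ⟺ Accepts r ρ
    Accepts-run L r ρ h = let e = accept-run-length L (sum ρ) r ρ h (<ᵥp^sum ρ) in trans (sym e) , trans e

    Accepts-step : ∀ r ρ → Accepts r ρ ⟺ Accepts (δ M r (lowDigits ρ)) (highParts ρ)
    Accepts-step r ρ =
      ⟺-trans (⟺-sym (Accepts-run (suc B) r ρ ρ<))
              (Accepts-run B (δ M r (lowDigits ρ)) (highParts ρ) (highParts-<ᵥ ρ B ρ<))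
      where
      B = sum ρ
      ρ< : ρ <ᵥ p ^ suc B
      ρ< i = <-≤-trans (<ᵥp^sum ρ i) (p^-mono-≤ (n≤1+n B))

  module Projection {n} (M : DFA (suc n)) (zs : ZeroStable M) where
    open Acceptance M zs

    S : ℕ
    S = states M

    0ᵥ : Vec ℕ n
    0ᵥ = zeros n

    digitFin : ℕ → Fin p
    digitFin x = fromℕ< (m%n<n x p)

    Accepts-step-0ᵥ : ∀ r x → Accepts r (x ∷ 0ᵥ) ⟺ Accepts (δ M r (x % p ∷ 0ᵥ)) (x / p ∷ 0ᵥ)
    Accepts-step-0ᵥ r x =
      subst₂ (λ c d → Accepts r (x ∷ 0ᵥ) ⟺ Accepts (δ M r (x % p ∷ c)) (x / p ∷ d))
        (lowDigits-zeros n) (highParts-zeros n) (Accepts-step r (x ∷ 0ᵥ))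

    Accepts-digit : ∀ r (d : Fin p) x → Accepts (δ M r (toℕ d ∷ 0ᵥ)) (x ∷ 0ᵥ) → Accepts r (toℕ d + p * x ∷ 0ᵥ)
    Accepts-digit r d x acc = proj₂ (Accepts-step-0ᵥ r (toℕ d + p * x))
      (subst₂ (λ a b → Accepts (δ M r (a ∷ 0ᵥ)) (b ∷ 0ᵥ))
        (sym ([d+p*m]%p≡d (toℕ d) x (toℕ<n d))) (sym ([d+p*m]/p≡m (toℕ d) x (toℕ<n d))) acc)

    stepsInto : Vec Bool S → Fin S → Fin p → Bool
    stepsInto v r d = lookup v (δ M r (toℕ d ∷ 0ᵥ))

    saturate : Vec Bool S → Vec Bool S
    saturate v = tabulate (λ r → lookup v r ∨ anyFin p (stepsInto v r))

    saturate-⊇ : ∀ v → v ⊆ᵇ saturate v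
    saturate-⊇ v r e = trans (lookup∘tabulate _ r) (proj₂ ∨≡true (inj₁ e))

    reach : ℕ → Vec Bool S
    reach zero = tabulate (accept M)
    reach (suc j) = saturate (reach j)

    reach-sem : ∀ j r → lookup (reach j) r ≡ true ⟺ Σ ℕ λ x → x < p ^ j × Accepts r (x ∷ 0ᵥ)
    reach-sem zero r =
      ⟺-trans (≡-⟺ (lookup∘tabulate (accept M) r) refl)
        (⟺-trans (Accepts-run 0 r (0 ∷ 0ᵥ) 0<ᵥ1)
          ((λ acc → 0 , s≤s z≤n , acc) , λ { (zero , _ , acc) → acc ; (suc _ , s≤s () , _) }))
      where
      0<ᵥ1 : (0 ∷ 0ᵥ) <ᵥ 1
      0<ᵥ1 i = subst (_< 1) (sym (lookup-zeros {suc n} i)) (s≤s z≤n)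
    reach-sem (suc j) r = to , from
      where
      to : lookup (reach (suc j)) r ≡ true → Σ ℕ λ x → x < p ^ suc j × Accepts r (x ∷ 0ᵥ)
      to e with proj₁ ∨≡true (trans (sym (lookup∘tabulate _ r)) e)
      ... | inj₁ here = let (x , x< , acc) = proj₁ (reach-sem j r) here
                        in x , <-≤-trans x< (p^-mono-≤ (n≤1+n j)) , acc
      ... | inj₂ later =
        let (d , e′) = proj₁ (anyFin≡true p (stepsInto (reach j) r)) later
            (x , x< , acc) = proj₁ (reach-sem j _) e′
        in toℕ d + p * x , d+p*m<p*n (toℕ<n d) x< , Accepts-digit r d x acc
      from : (Σ ℕ λ x → x < p ^ suc j × Accepts r (x ∷ 0ᵥ)) → lookup (reach (suc j)) r ≡ true
      from (x , x< , acc) =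
        let acc′ = subst (λ t → Accepts (δ M r (t ∷ 0ᵥ)) (x / p ∷ 0ᵥ)) (sym (toℕ-fromℕ< (m%n<n x p)))
                     (proj₁ (Accepts-step-0ᵥ r x) acc)
            later = proj₂ (anyFin≡true p (stepsInto (reach j) r))
                      (digitFin x , proj₂ (reach-sem j _) (x / p , m/p<p^k {x} {j} x< , acc′))
        in trans (lookup∘tabulate _ r) (proj₂ (∨≡true {lookup (reach j) r}) (inj₂ later))

    reach-⊆ : ∀ j m → reach j ⊆ᵇ reach (m + j)
    reach-⊆ j zero r e = e
    reach-⊆ j (suc m) r e = saturate-⊇ (reach (m + j)) r (reach-⊆ j m r e)

    reach-fixed : ∀ i → saturate (reach i) ≡ reach i → ∀ m → reach (m + i) ≡ reach i
    reach-fixed i fix zero = refl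
    reach-fixed i fix (suc m) = trans (cong saturate (reach-fixed i fix m)) fix

    -- Each non-stationary step adds a state, so the iteration is stationary after S + 1 steps.
    reach-stationary-or-grows : ∀ j → (Σ ℕ λ i → i ≤ j × saturate (reach i) ≡ reach i) ⊎ j ≤ size (reach j)
    reach-stationary-or-grows zero = inj₂ z≤n
    reach-stationary-or-grows (suc j) with reach-stationary-or-grows j
    ... | inj₁ (i , i≤j , fix) = inj₁ (i , m≤n⇒m≤1+n i≤j , fix)
    ... | inj₂ j≤size with ≡-dec Bool._≟_ (saturate (reach j)) (reach j)
    ...   | yes fix = inj₁ (j , n≤1+n j , fix)
    ...   | no grows = inj₂ (≤-<-trans j≤size (⊂ᵇ⇒size< _ _ (saturate-⊇ (reach j)) (λ e → grows (sym e))))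

    reach-stationary : Σ ℕ λ i → i ≤ suc S × saturate (reach i) ≡ reach i
    reach-stationary with reach-stationary-or-grows (suc S)
    ... | inj₁ stat = stat
    ... | inj₂ h = ⊥-elim (<⇒≱ (s≤s ≤-refl) (≤-trans h (size≤ (reach (suc S)))))

    reach∞ : Vec Bool S
    reach∞ = reach (suc S)

    reach-⊆-reach∞ : ∀ j → reach j ⊆ᵇ reach∞
    reach-⊆-reach∞ j r e =
      let (i , i≤ , fix) = reach-stationary
          e′ = subst (λ t → lookup t r ≡ true) (trans (cong reach (+-comm i j)) (reach-fixed i fix j)) (reach-⊆ j i r e)
      in subst (λ t → lookup t r ≡ true) (trans (sym (reach-fixed i fix (suc S ∸ i))) (cong reach (m∸n+n≡m i≤))) e′

    reach∞-sem : ∀ r → lookup reach∞ r ≡ true ⟺ Σ ℕ λ x → Accepts r (x ∷ 0ᵥ)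
    reach∞-sem r = (λ e → let (x , _ , acc) = proj₁ (reach-sem (suc S) r) e in x , acc) ,
                   (λ (x , acc) → reach-⊆-reach∞ x r (proj₂ (reach-sem x r) (x , n<p^n x , acc)))

    movesTo : Vec Bool S → Vec ℕ n → Fin S → Fin S → Fin p → Bool
    movesTo v c r′ r d = lookup v r ∧ δ M r (toℕ d ∷ c) == r′

    successors : Vec Bool S → Vec ℕ n → Vec Bool S
    successors v c = tabulate (λ r′ → anyFin S (λ r → anyFin p (movesTo v c r′ r)))

    successors-sem : ∀ v c r′ → lookup (successors v c) r′ ≡ true ⟺
                     Σ (Fin S) λ r → Σ (Fin p) λ d → lookup v r ≡ true × δ M r (toℕ d ∷ c) ≡ r′
    successors-sem v c r′ =
      ⟺-trans (≡-⟺ (lookup∘tabulate _ r′) refl)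
        (⟺-trans (anyFin≡true S _)
          ((λ (r , e) → r , Data.Product.map₂ (proj₁ moves) (proj₁ (anyFin≡true p (movesTo v c r′ r)) e)) ,
           (λ (r , d , e) → r , proj₂ (anyFin≡true p (movesTo v c r′ r)) (d , proj₂ moves e))))
      where
      moves : ∀ {r d} → movesTo v c r′ r d ≡ true ⟺ (lookup v r ≡ true × δ M r (toℕ d ∷ c) ≡ r′)
      moves = ⟺-trans ∧≡true (×-⟺ ⟺-refl (==≡true _ _))

    projected : DFA n
    projected = record
      { states = 2 ^ S
      ; start = encode (tabulate (_== start M))
      ; δ = λ i c → encode (successors (decode i) c)
      ; accept = λ i → anyFin S (λ r → lookup (decode i) r ∧ lookup reach∞ r) }

    SomeAccepts : Fin (2 ^ S) → Vec ℕ n → Set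
    SomeAccepts i ρ = Σ (Fin S) λ r → lookup (decode i) r ≡ true × Σ ℕ λ x → Accepts r (x ∷ ρ)

    SomeAccepts-base : ∀ i → accept projected i ≡ true ⟺ SomeAccepts i 0ᵥ
    SomeAccepts-base i = ⟺-trans (anyFin≡true S _)
      ((λ (r , e) → let (e₁ , e₂) = proj₁ ∧≡true e in r , e₁ , proj₁ (reach∞-sem r) e₂) ,
       (λ (r , e₁ , acc) → r , proj₂ ∧≡true (e₁ , proj₂ (reach∞-sem r) acc)))

    SomeAccepts-step : ∀ i ρ → SomeAccepts i ρ ⟺ SomeAccepts (δ projected i (lowDigits ρ)) (highParts ρ)
    SomeAccepts-step i ρ = to , from
      where
      c = lowDigits ρ
      decode-step : ∀ r′ → lookup (decode (δ projected i c)) r′ ≡ true ⟺ lookup (successors (decode i) c) r′ ≡ true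
      decode-step r′ = ≡-⟺ (cong (λ w → lookup w r′) (decode-encode (successors (decode i) c))) refl
      to : SomeAccepts i ρ → SomeAccepts (δ projected i c) (highParts ρ)
      to (r , e , x , acc) =
        δ M r (x % p ∷ c) ,
        proj₂ (decode-step _) (proj₂ (successors-sem (decode i) c (δ M r (x % p ∷ c)))
          (r , digitFin x , e , cong (λ t → δ M r (t ∷ c)) (toℕ-fromℕ< (m%n<n x p)))) ,
        x / p , proj₁ (Accepts-step r (x ∷ ρ)) acc
      from : SomeAccepts (δ projected i c) (highParts ρ) → SomeAccepts i ρ
      from (r′ , e , x , acc) =
        let (r , d , e′ , r→r′) = proj₁ (successors-sem (decode i) c r′) (proj₁ (decode-step r′) e)
            acc′ = subst₂ (λ a b → Accepts (δ M r (a ∷ c)) (b ∷ highParts ρ))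
                     (sym ([d+p*m]%p≡d (toℕ d) x (toℕ<n d))) (sym ([d+p*m]/p≡m (toℕ d) x (toℕ<n d)))
                     (subst (λ t → Accepts t (x ∷ highParts ρ)) (sym r→r′) acc)
        in r , e′ , toℕ d + p * x , proj₂ (Accepts-step r (toℕ d + p * x ∷ ρ)) acc′

  Automatic-∃ : ∀ {n R} → Automatic (suc n) R → Automatic n (λ ρ → Σ ℕ λ x → R (x ∷ ρ))
  Automatic-∃ {n} {R} (M , zs , rec) =
    Automatic-resp (automatic-by-invariant projected SomeAccepts SomeAccepts-base SomeAccepts-step) start-sem
    where
    open Projection M zs
    open Acceptance M zs
    initial : Vec Bool (states M)
    initial = tabulate (_== start M)
    start-sem : ∀ ρ → SomeAccepts (start projected) ρ ⟺ (Σ ℕ λ x → R (x ∷ ρ))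
    start-sem ρ =
      (λ (r , e , x , acc) →
        let r≡start = proj₁ (==≡true _ _) (trans (sym (lookup∘tabulate _ r))
                        (subst (λ w → lookup w r ≡ true) (decode-encode initial) e))
        in x , proj₁ (rec (sum (x ∷ ρ)) (x ∷ ρ) (<ᵥp^sum (x ∷ ρ)))
                 (subst (λ t → Accepts t (x ∷ ρ)) r≡start acc)) ,
      (λ (x , r) → start M ,
        subst (λ w → lookup w (start M) ≡ true) (sym (decode-encode initial))
          (trans (lookup∘tabulate _ (start M)) (proj₂ (==≡true _ _) refl)) ,
        x , proj₂ (rec (sum (x ∷ ρ)) (x ∷ ρ) (<ᵥp^sum (x ∷ ρ))) r)

  choose : ∀ {m} → ℕ → ℕ → Fin m → Fin m → Fin m
  choose a b r r′ with a ≟ b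
  ... | yes _ = r
  ... | no _ = r′

  choose-spec : ∀ {m} a b (r r′ : Fin m) → (a ≡ b × choose a b r r′ ≡ r) ⊎ (a ≢ b × choose a b r r′ ≡ r′)
  choose-spec a b r r′ with a ≟ b
  ... | yes e = inj₁ (e , refl)
  ... | no ne = inj₂ (ne , refl)

  ⟺-subst : ∀ {m} {A : Set} (P : Fin m → Set) {r r′} → r ≡ r′ → A ⟺ P r′ → A ⟺ P r
  ⟺-subst P refl h = h

  ≡-step : ∀ x y → x ≡ y ⟺ (x % p ≡ y % p × x / p ≡ y / p)
  ≡-step x y = (λ e → cong (_% p) e , cong (_/ p) e) ,
               (λ (e₁ , e₂) → trans (m≡m%p+p*[m/p] x)
                                (trans (cong₂ (λ a b → a + p * b) e₁ e₂) (sym (m≡m%p+p*[m/p] y))))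

  equalityDFA : DFA 2
  equalityDFA = record { states = 2 ; start = zero ; δ = step ; accept = λ { zero → true ; (suc zero) → false } }
    where
    step : Fin 2 → Vec ℕ 2 → Fin 2
    step zero (x ∷ y ∷ []) = choose x y zero (suc zero)
    step (suc zero) _ = suc zero

  Automatic-≡ : Automatic 2 (λ ρ → lookup ρ zero ≡ lookup ρ (suc zero))
  Automatic-≡ = Automatic-resp (automatic-by-invariant equalityDFA Equal base step) (λ { (x ∷ y ∷ []) → ⟺-refl })
    where
    Equal : Fin 2 → Vec ℕ 2 → Set
    Equal zero (x ∷ y ∷ []) = x ≡ y
    Equal (suc zero) _ = ⊥
    base : ∀ r → accept equalityDFA r ≡ true ⟺ Equal r (zeros 2)
    base zero = (λ _ → refl) , (λ _ → refl)
    base (suc zero) = (λ ()) , (λ ())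
    step : ∀ r ρ → Equal r ρ ⟺ Equal (δ equalityDFA r (lowDigits ρ)) (highParts ρ)
    step zero (x ∷ y ∷ []) with choose-spec (x % p) (y % p) zero (suc zero)
    ... | inj₁ (e , r≡) = ⟺-subst (λ r → Equal r (x / p ∷ y / p ∷ [])) r≡
                            ((λ h → proj₂ (proj₁ (≡-step x y) h)) , (λ h → proj₂ (≡-step x y) (e , h)))
    ... | inj₂ (ne , r≡) =
      ⟺-subst (λ r → Equal r (x / p ∷ y / p ∷ [])) r≡ ((λ h → ne (proj₁ (proj₁ (≡-step x y) h))) , λ ())
    step (suc zero) ρ = ⟺-refl

  +-step : ∀ x y z c → x + y + c ≡ z ⟺
           ((x % p + y % p + c) % p ≡ z % p × x / p + y / p + (x % p + y % p + c) / p ≡ z / p)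
  +-step x y z c =
    (λ e → d+p*m-injective (m%n<n t p) (m%n<n z p) (trans (sym split) (trans e (m≡m%p+p*[m/p] z)))) ,
    (λ (e₁ , e₂) → trans split (trans (cong₂ (λ a b → a + p * b) e₁ e₂) (sym (m≡m%p+p*[m/p] z))))
    where
    t = x % p + y % p + c
    split : x + y + c ≡ t % p + p * (x / p + y / p + t / p)
    split =
      trans (cong₂ (λ a b → a + b + c) (m≡m%p+p*[m/p] x) (m≡m%p+p*[m/p] y))
        (trans (ring₁ (x % p) (y % p) c (x / p) (y / p) p)
          (trans (cong (λ s → s + p * (x / p + y / p)) (m≡m%p+p*[m/p] t)) (ring₂ (t % p) (t / p) (x / p) (y / p) p)))
      where
      ring₁ : ∀ a b c x′ y′ P → a + P * x′ + (b + P * y′) + c ≡ (a + b + c) + P * (x′ + y′)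
      ring₁ = solve-∀
      ring₂ : ∀ r s x′ y′ P → r + P * s + P * (x′ + y′) ≡ r + P * (x′ + y′ + s)
      ring₂ = solve-∀

  carry≤1 : ∀ x y c → c ≤ 1 → (x % p + y % p + c) / p ≤ 1
  carry≤1 x y c c≤1 = ≤-pred (m<n*o⇒m/o<n {x % p + y % p + c} {2} {p}
    (subst (x % p + y % p + c <_) (cong (p +_) (sym (+-identityʳ p)))
      (subst (_< p + p) (sym (+-assoc (x % p) (y % p) c))
        (+-mono-<-≤ (m%n<n x p)
          (≤-trans (+-monoʳ-≤ (y % p) c≤1) (≤-trans (≤-reflexive (+-comm (y % p) 1)) (m%n<n y p)))))))

  addTransition : ℕ → ℕ → Fin 3
  addTransition t d = choose (t % p) d (choose (t / p) 0 zero (suc zero)) (suc (suc zero))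

  additionDFA : DFA 3
  additionDFA = record { states = 3 ; start = zero ; δ = step ; accept = λ { zero → true ; _ → false } }
    where
    step : Fin 3 → Vec ℕ 3 → Fin 3
    step zero (x ∷ y ∷ z ∷ []) = addTransition (x + y + 0) z
    step (suc zero) (x ∷ y ∷ z ∷ []) = addTransition (x + y + 1) z
    step (suc (suc zero)) _ = suc (suc zero)

  SumWithCarry : Fin 3 → Vec ℕ 3 → Set
  SumWithCarry zero (x ∷ y ∷ z ∷ []) = x + y + 0 ≡ z
  SumWithCarry (suc zero) (x ∷ y ∷ z ∷ []) = x + y + 1 ≡ z
  SumWithCarry (suc (suc zero)) _ = ⊥

  +-step-carry : ∀ x y z c {k} → (x % p + y % p + c) % p ≡ z % p → (x % p + y % p + c) / p ≡ k →
                 x + y + c ≡ z ⟺ x / p + y / p + k ≡ z / p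
  +-step-carry x y z c digit≡ refl = ⟺-trans (+-step x y z c) ((λ (_ , h) → h) , (λ h → digit≡ , h))

  carry-step : ∀ c x y z → c ≤ 1 →
               x + y + c ≡ z ⟺ SumWithCarry (addTransition (x % p + y % p + c) (z % p)) (x / p ∷ y / p ∷ z / p ∷ [])
  carry-step c x y z c≤1
    with choose-spec (t % p) (z % p) (choose (t / p) 0 zero (suc zero)) (suc (suc zero))
       | choose-spec (t / p) 0 zero (suc zero)
    where t = x % p + y % p + c
  ... | inj₂ (ne , r≡) | _ = ⟺-subst (λ r → SumWithCarry r _) r≡ ((λ h → ne (proj₁ (proj₁ (+-step x y z c) h))) , λ ())
  ... | inj₁ (e , r≡) | inj₁ (carry≡0 , r′≡) =
    ⟺-subst (λ r → SumWithCarry r _) (trans r≡ r′≡) (+-step-carry x y z c e carry≡0)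
  ... | inj₁ (e , r≡) | inj₂ (carry≢0 , r′≡) =
    ⟺-subst (λ r → SumWithCarry r _) (trans r≡ r′≡) (+-step-carry x y z c e carry≡1)
    where
    carry≡1 : (x % p + y % p + c) / p ≡ 1
    carry≡1 = ≤-antisym (carry≤1 x y c c≤1) (n≢0⇒n>0 carry≢0)

  Automatic-+ : Automatic 3 (λ ρ → lookup ρ zero + lookup ρ (suc zero) ≡ lookup ρ (suc (suc zero)))
  Automatic-+ = Automatic-resp (automatic-by-invariant additionDFA SumWithCarry base step)
    (λ { (x ∷ y ∷ z ∷ []) → subst (λ s → s ≡ z ⟺ x + y ≡ z) (sym (+-identityʳ (x + y))) ⟺-refl })
    where
    base : ∀ r → accept additionDFA r ≡ true ⟺ SumWithCarry r (zeros 3)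
    base zero = (λ _ → refl) , (λ _ → refl)
    base (suc zero) = (λ ()) , (λ ())
    base (suc (suc zero)) = (λ ()) , (λ ())
    step : ∀ r ρ → SumWithCarry r ρ ⟺ SumWithCarry (δ additionDFA r (lowDigits ρ)) (highParts ρ)
    step zero (x ∷ y ∷ z ∷ []) = carry-step 0 x y z z≤n
    step (suc zero) (x ∷ y ∷ z ∷ []) = carry-step 1 x y z (s≤s z≤n)
    step (suc (suc zero)) ρ = ⟺-refl

  oneDFA : DFA 1
  oneDFA = record { states = 3 ; start = zero ; δ = step ; accept = λ { (suc zero) → true ; _ → false } }
    where
    step : Fin 3 → Vec ℕ 1 → Fin 3
    step zero (x ∷ []) = choose x 1 (suc zero) (suc (suc zero))
    step (suc zero) (x ∷ []) = choose x 0 (suc zero) (suc (suc zero))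
    step (suc (suc zero)) _ = suc (suc zero)

  Automatic-≡1 : Automatic 1 (λ ρ → lookup ρ zero ≡ 1)
  Automatic-≡1 = Automatic-resp (automatic-by-invariant oneDFA Value base step) (λ { (x ∷ []) → ⟺-refl })
    where
    Value : Fin 3 → Vec ℕ 1 → Set
    Value zero (x ∷ []) = x ≡ 1
    Value (suc zero) (x ∷ []) = x ≡ 0
    Value (suc (suc zero)) _ = ⊥
    base : ∀ r → accept oneDFA r ≡ true ⟺ Value r (zeros 1)
    base zero = (λ ()) , (λ ())
    base (suc zero) = (λ _ → refl) , (λ _ → refl)
    base (suc (suc zero)) = (λ ()) , (λ ())
    step : ∀ r ρ → Value r ρ ⟺ Value (δ oneDFA r (lowDigits ρ)) (highParts ρ)
    step zero (x ∷ []) with choose-spec (x % p) 1 (suc zero) (suc (suc zero))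
    ... | inj₁ (e , r≡) = ⟺-subst (λ r → Value r (x / p ∷ [])) r≡ (≡1-step e)
    ... | inj₂ (ne , r≡) = ⟺-subst (λ r → Value r (x / p ∷ [])) r≡ ((λ x≡1 → ne (cong (_% p) x≡1)) , λ ())
    step (suc zero) (x ∷ []) with choose-spec (x % p) 0 (suc zero) (suc (suc zero))
    ... | inj₁ (e , r≡) = ⟺-subst (λ r → Value r (x / p ∷ [])) r≡ (≡0-step e)
    ... | inj₂ (ne , r≡) = ⟺-subst (λ r → Value r (x / p ∷ [])) r≡ ((λ x≡0 → ne (cong (_% p) x≡0)) , λ ())
    step (suc (suc zero)) ρ = ⟺-refl

  valuationTransition : ℕ → ℕ → Fin 3
  valuationTransition x y =
    choose x 0 (choose y 0 zero (suc (suc zero))) (choose x 1 (choose y 0 (suc (suc zero)) (suc zero)) (suc (suc zero)))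

  valuationDFA : DFA 2
  valuationDFA = record { states = 3 ; start = zero ; δ = step ; accept = λ { (suc zero) → true ; _ → false } }
    where
    step : Fin 3 → Vec ℕ 2 → Fin 3
    step zero (x ∷ y ∷ []) = valuationTransition x y
    step (suc zero) (x ∷ y ∷ []) = choose x 0 (suc zero) (suc (suc zero))
    step (suc (suc zero)) _ = suc (suc zero)

  -- State 1 is reached after the digit 1 of x, so the remaining digits of x must be 0.
  Valuation : Fin 3 → Vec ℕ 2 → Set
  Valuation zero (x ∷ y ∷ []) = V p x y
  Valuation (suc zero) (x ∷ y ∷ []) = x ≡ 0
  Valuation (suc (suc zero)) _ = ⊥

  module _ (x y : ℕ) where

    HighValuation : Fin 3 → Set
    HighValuation r = Valuation r (x / p ∷ y / p ∷ [])

    valuation-step : V p x y ⟺ Valuation (valuationTransition (x % p) (y % p)) (x / p ∷ y / p ∷ [])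
    valuation-step
      with choose-spec (x % p) 0 (choose (y % p) 0 zero (suc (suc zero)))
                       (choose (x % p) 1 (choose (y % p) 0 (suc (suc zero)) (suc zero)) (suc (suc zero)))
    ... | inj₁ (x₀≡0 , r≡) with choose-spec (y % p) 0 zero (suc (suc zero))
    ...   | inj₁ (y₀≡0 , r′≡) = ⟺-subst HighValuation (trans r≡ r′≡) (V-step-0-0 x₀≡0 y₀≡0)
    ...   | inj₂ (y₀≢0 , r′≡) = ⟺-subst HighValuation (trans r≡ r′≡) (¬V-step-0-≢0 x₀≡0 y₀≢0 , λ ())
    valuation-step | inj₂ (x₀≢0 , r≡)
      with choose-spec (x % p) 1 (choose (y % p) 0 (suc (suc zero)) (suc zero)) (suc (suc zero))
    ...   | inj₂ (x₀≢1 , r′≡) = ⟺-subst HighValuation (trans r≡ r′≡) (¬V-step-≥2 (2≤ x₀≢0 x₀≢1) , λ ())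
      where
      2≤ : ∀ {a} → a ≢ 0 → a ≢ 1 → 2 ≤ a
      2≤ {zero} a≢0 _ = ⊥-elim (a≢0 refl)
      2≤ {suc zero} _ a≢1 = ⊥-elim (a≢1 refl)
      2≤ {suc (suc a)} _ _ = s≤s (s≤s z≤n)
    ...   | inj₁ (x₀≡1 , r′≡) with choose-spec (y % p) 0 (suc (suc zero)) (suc zero)
    ...     | inj₁ (y₀≡0 , r″≡) = ⟺-subst HighValuation (trans r≡ (trans r′≡ r″≡)) (¬V-step-1-0 x₀≡1 y₀≡0 , λ ())
    ...     | inj₂ (y₀≢0 , r″≡) = ⟺-subst HighValuation (trans r≡ (trans r′≡ r″≡)) (V-step-1-≢0 x₀≡1 y₀≢0)

  Automatic-V : Automatic 2 (λ ρ → V p (lookup ρ zero) (lookup ρ (suc zero)))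
  Automatic-V = Automatic-resp (automatic-by-invariant valuationDFA Valuation base step) (λ { (x ∷ y ∷ []) → ⟺-refl })
    where
    base : ∀ r → accept valuationDFA r ≡ true ⟺ Valuation r (zeros 2)
    base zero = (λ ()) , (λ v → ⊥-elim (¬V-0 v))
    base (suc zero) = (λ _ → refl) , (λ _ → refl)
    base (suc (suc zero)) = (λ ()) , (λ ())
    step : ∀ r ρ → Valuation r ρ ⟺ Valuation (δ valuationDFA r (lowDigits ρ)) (highParts ρ)
    step zero (x ∷ y ∷ []) = valuation-step x y
    step (suc zero) (x ∷ y ∷ []) with choose-spec (x % p) 0 (suc zero) (suc (suc zero))
    ... | inj₁ (e , r≡) = ⟺-subst (λ r → Valuation r (x / p ∷ y / p ∷ [])) r≡ (≡0-step e)
    ... | inj₂ (ne , r≡) =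
      ⟺-subst (λ r → Valuation r (x / p ∷ y / p ∷ [])) r≡ ((λ x≡0 → ne (cong (_% p) x≡0)) , λ ())
    step (suc (suc zero)) ρ = ⟺-refl

  -- Every formula defines an automatic relation

  Graph : ∀ {n} → Term n → Vec ℕ (suc n) → Set
  Graph t (z ∷ ρ) = z ≡ evalT ρ t

  module _ {n : ℕ} where

    track₂ : Fin 2 → Fin (suc n) → Fin (2 + n)
    track₂ k zero = k ↑ˡ n
    track₂ k (suc i) = suc (suc i)

    track₃ : Fin 3 → Fin (suc n) → Fin (3 + n)
    track₃ k zero = k ↑ˡ n
    track₃ k (suc i) = suc (suc (suc i))

    select-track₂ : ∀ a b (ρ : Vec ℕ n) k → select (track₂ k) (a ∷ b ∷ ρ) ≡ lookup (a ∷ b ∷ []) k ∷ ρ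
    select-track₂ a b ρ zero = cong (a ∷_) (tabulate∘lookup ρ)
    select-track₂ a b ρ (suc zero) = cong (b ∷_) (tabulate∘lookup ρ)

    select-track₃ : ∀ a b c (ρ : Vec ℕ n) k →
                    select (track₃ k) (a ∷ b ∷ c ∷ ρ) ≡ lookup (a ∷ b ∷ c ∷ []) k ∷ ρ
    select-track₃ a b c ρ zero = cong (a ∷_) (tabulate∘lookup ρ)
    select-track₃ a b c ρ (suc zero) = cong (b ∷_) (tabulate∘lookup ρ)
    select-track₃ a b c ρ (suc (suc zero)) = cong (c ∷_) (tabulate∘lookup ρ)

  Automatic-Graph : ∀ {n} (t : Term n) → Automatic (suc n) (Graph t)
  Automatic-Graph {n} (var i) = Automatic-resp (Automatic-select tracks Automatic-≡) (λ { (z ∷ ρ) → ⟺-refl })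
    where
    tracks : Fin 2 → Fin (suc n)
    tracks zero = zero
    tracks (suc zero) = suc i
  Automatic-Graph {n} zer = Automatic-resp (Automatic-select (λ _ → zero) Automatic-+)
    (λ { (z ∷ ρ) → (λ z+z≡z → +-cancelˡ-≡ z z 0 (trans z+z≡z (sym (+-identityʳ z)))) , (λ { refl → refl }) })
  Automatic-Graph {n} one = Automatic-resp (Automatic-select (λ _ → zero) Automatic-≡1) (λ { (z ∷ ρ) → ⟺-refl })
  Automatic-Graph {n} (plus s t) =
    Automatic-resp
      (Automatic-∃ (Automatic-∃ (Automatic-× (Automatic-× (Automatic-select (track₃ zero) (Automatic-Graph s))
                                                           (Automatic-select (track₃ (suc zero)) (Automatic-Graph t)))
                                              (Automatic-select (_↑ˡ n) Automatic-+))))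
      (λ { (z ∷ ρ) → sum-graph z ρ })
    where
    sum-graph : ∀ z ρ → (Σ ℕ λ b → Σ ℕ λ a → (Graph s (select (track₃ zero) (a ∷ b ∷ z ∷ ρ)) ×
                                               Graph t (select (track₃ (suc zero)) (a ∷ b ∷ z ∷ ρ))) × a + b ≡ z)
                        ⟺ z ≡ evalT ρ s + evalT ρ t
    sum-graph z ρ =
      (λ (b , a , (a≡ , b≡) , a+b≡z) →
        trans (sym a+b≡z) (cong₂ _+_ (subst (Graph s) (select-track₃ a b z ρ zero) a≡)
                                     (subst (Graph t) (select-track₃ a b z ρ (suc zero)) b≡))) ,
      (λ z≡ → evalT ρ t , evalT ρ s ,
        (subst (Graph s) (sym (select-track₃ (evalT ρ s) (evalT ρ t) z ρ zero)) refl ,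
         subst (Graph t) (sym (select-track₃ (evalT ρ s) (evalT ρ t) z ρ (suc zero))) refl) , sym z≡)

  Automatic-QF : ∀ {n} (φ : QF n) → Automatic n (λ ρ → SatQF p ρ φ)
  Automatic-QF (eq s t) = Automatic-resp (Automatic-∃ (Automatic-× (Automatic-Graph s) (Automatic-Graph t)))
    λ ρ → (λ (z , z≡s , z≡t) → trans (sym z≡s) z≡t) , (λ e → evalT ρ s , refl , e)
  Automatic-QF {n} (vp s t) =
    Automatic-resp
      (Automatic-∃ (Automatic-∃ (Automatic-× (Automatic-× (Automatic-select (track₂ zero) (Automatic-Graph s))
                                                           (Automatic-select (track₂ (suc zero)) (Automatic-Graph t)))
                                              (Automatic-select (_↑ˡ n) Automatic-V))))
      valuation
    where
    valuation : ∀ ρ → (Σ ℕ λ b → Σ ℕ λ a → (Graph s (select (track₂ zero) (a ∷ b ∷ ρ)) ×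
                                             Graph t (select (track₂ (suc zero)) (a ∷ b ∷ ρ))) × V p a b)
                      ⟺ V p (evalT ρ s) (evalT ρ t)
    valuation ρ =
      (λ (b , a , (a≡ , b≡) , v) → subst₂ (V p) (subst (Graph s) (select-track₂ a b ρ zero) a≡)
                                                (subst (Graph t) (select-track₂ a b ρ (suc zero)) b≡) v) ,
      (λ v → evalT ρ t , evalT ρ s ,
        (subst (Graph s) (sym (select-track₂ (evalT ρ s) (evalT ρ t) ρ zero)) refl ,
         subst (Graph t) (sym (select-track₂ (evalT ρ s) (evalT ρ t) ρ (suc zero))) refl) , v)
  Automatic-QF (neg φ) = Automatic-¬ (Automatic-QF φ)
  Automatic-QF (conj φ ψ) = Automatic-× (Automatic-QF φ) (Automatic-QF ψ)
  Automatic-QF (disj φ ψ) = Automatic-⊎ (Automatic-QF φ) (Automatic-QF ψ)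

  Automatic-∃ᵛ : ∀ k {n R} → Automatic (k + n) R → Automatic n (λ ρ → Σ (Vec ℕ k) λ xs → R (xs ++ ρ))
  Automatic-∃ᵛ zero a = Automatic-resp a (λ ρ → (λ r → [] , r) , (λ { ([] , r) → r }))
  Automatic-∃ᵛ (suc k) a = Automatic-resp (Automatic-∃ᵛ k (Automatic-∃ a))
    (λ ρ → (λ (xs , x , r) → x ∷ xs , r) , (λ { (x ∷ xs , r) → xs , x , r }))

  Automatic-Sig : ∀ {i n} (φ : Sig i n) → Automatic n (λ ρ → SatS p ρ φ)
  Automatic-Pi : ∀ {i n} (φ : Pi i n) → Automatic n (λ ρ → SatP p ρ φ)
  Automatic-Sig (qfS φ) = Automatic-QF φ
  Automatic-Sig (ex k φ) = Automatic-∃ᵛ k (Automatic-Pi φ)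
  Automatic-Pi (qfP φ) = Automatic-QF φ
  Automatic-Pi (all k φ) = Automatic-resp (Automatic-¬ (Automatic-∃ᵛ k (Automatic-¬ (Automatic-Sig φ))))
    (λ ρ → (λ ¬∃¬ xs → stable (xs ++ ρ) (λ ¬φ → ¬∃¬ (xs , ¬φ))) , (λ ∀φ (xs , ¬φ) → ¬φ (∀φ xs)))
    where
    -- Automatic relations are decidable, which is what makes ∀ = ¬∃¬ valid constructively.
    stable : ∀ σ → ¬ ¬ SatS p σ φ → SatS p σ φ
    stable σ ¬¬φ with Automatic-dec (Automatic-Sig φ) σ
    ... | yes s = s
    ... | no ¬s = ⊥-elim (¬¬φ ¬s)

  -- Automatic relations are Σ₂

  ⊤ᶠ ⊥ᶠ : ∀ {m} → QF m
  ⊤ᶠ = eq zer zer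
  ⊥ᶠ = neg ⊤ᶠ

  _⇒ᶠ_ : ∀ {m} → QF m → QF m → QF m
  A ⇒ᶠ B = disj (neg A) B

  ⋀ ⋁ : ∀ {m} k → (Fin k → QF m) → QF m
  ⋀ zero f = ⊤ᶠ
  ⋀ (suc k) f = conj (f zero) (⋀ k (λ i → f (suc i)))
  ⋁ zero f = ⊥ᶠ
  ⋁ (suc k) f = disj (f zero) (⋁ k (λ i → f (suc i)))

  ⋀-digits : ∀ {m} k → (Vec ℕ k → QF m) → QF m
  ⋀-digits zero f = f []
  ⋀-digits (suc k) f = ⋀ p (λ d → ⋀-digits k (λ c → f (toℕ d ∷ c)))

  _·_ : ∀ {m} → ℕ → Term m → Term m
  zero · t = zer
  suc v · t = plus t (v · t)

  module _ {m} (η : Vec ℕ m) where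

    Sat : QF m → Set
    Sat = SatQF p η

    ⟦_⟧ : Term m → ℕ
    ⟦_⟧ = evalT η

    ⟦·⟧ : ∀ v t → ⟦ v · t ⟧ ≡ v * ⟦ t ⟧
    ⟦·⟧ zero t = refl
    ⟦·⟧ (suc v) t = cong (⟦ t ⟧ +_) (⟦·⟧ v t)

    Sat-⋀ : ∀ k f → Sat (⋀ k f) ⟺ (∀ i → Sat (f i))
    Sat-⋀ zero f = (λ _ ()) , (λ _ → refl)
    Sat-⋀ (suc k) f =
      (λ (s₀ , s) → λ { zero → s₀ ; (suc i) → proj₁ (Sat-⋀ k (λ i → f (suc i))) s i }) ,
      (λ s → s zero , proj₂ (Sat-⋀ k (λ i → f (suc i))) (λ i → s (suc i)))

    Sat-⋁ : ∀ k f → Sat (⋁ k f) ⟺ (Σ (Fin k) λ i → Sat (f i))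
    Sat-⋁ zero f = (λ s → ⊥-elim (s refl)) , λ { (() , _) }
    Sat-⋁ (suc k) f =
      (λ { (inj₁ s) → zero , s ; (inj₂ s) → let (i , s′) = proj₁ (Sat-⋁ k (λ i → f (suc i))) s in suc i , s′ }) ,
      (λ { (zero , s) → inj₁ s ; (suc i , s) → inj₂ (proj₂ (Sat-⋁ k (λ i → f (suc i))) (i , s)) })

    Sat-⋀-digits : ∀ k f → Sat (⋀-digits k f) ⟺ (∀ c → c <ᵥ p → Sat (f c))
    Sat-⋀-digits zero f = (λ s → λ { [] _ → s }) , (λ s → s [] (λ ()))
    Sat-⋀-digits (suc k) f = to , from
      where
      to : Sat (⋀-digits (suc k) f) → ∀ c → c <ᵥ p → Sat (f c)
      to s (d ∷ c) c<p =
        let d′ = fromℕ< (c<p zero) in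
        subst (λ t → Sat (f (t ∷ c))) (toℕ-fromℕ< (c<p zero))
          (proj₁ (Sat-⋀-digits k (λ c → f (toℕ d′ ∷ c)))
                 (proj₁ (Sat-⋀ p (λ d → ⋀-digits k (λ c → f (toℕ d ∷ c)))) s d′)
            c (λ i → c<p (suc i)))
      from : (∀ c → c <ᵥ p → Sat (f c)) → Sat (⋀-digits (suc k) f)
      from s = proj₂ (Sat-⋀ p _) (λ d → proj₂ (Sat-⋀-digits k (λ c → f (toℕ d ∷ c))) (λ c c<p →
                 s (toℕ d ∷ c) (λ { zero → toℕ<n d ; (suc i) → c<p i })))

    Sat-dec : ∀ φ → Dec (Sat φ)
    Sat-dec φ = Automatic-dec (Automatic-QF φ) η

    Sat-⇒ᶠ : ∀ {A B} → (Sat A → Sat B) → Sat (A ⇒ᶠ B)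
    Sat-⇒ᶠ {A} A⇒B with Sat-dec A
    ... | yes a = inj₂ (A⇒B a)
    ... | no ¬a = inj₁ ¬a

    Sat-⇒ᶠ⁻ : ∀ {A B} → Sat (A ⇒ᶠ B) → Sat A → Sat B
    Sat-⇒ᶠ⁻ (inj₁ ¬a) a = ⊥-elim (¬a a)
    Sat-⇒ᶠ⁻ (inj₂ b) _ = b

  -- For a = p^k, a split x = y + t + z with t = v·a (v < p), z < a and y a multiple of p·a
  -- (detected through its valuation c ≥ p·a) forces t = digit x k · a.  This is how V_p
  -- reads a single digit.
  DigitSplit : ℕ → ℕ → Vec ℕ 6 → Set
  DigitSplit x a (y ∷ t ∷ z ∷ w ∷ c ∷ u ∷ []) =
    x ≡ y + t + z × z + w + 1 ≡ a × (Σ ℕ λ v → v < p × t ≡ v * a) × (y ≡ 0 ⊎ (V p c y × p * a + u ≡ c))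

  digitSplitᶠ : ∀ {m} → Term m → Term m → Vec (Term m) 6 → QF m
  digitSplitᶠ x a (y ∷ t ∷ z ∷ w ∷ c ∷ u ∷ []) =
    conj (eq x (plus (plus y t) z))
      (conj (eq (plus (plus z w) one) a)
        (conj (⋁ p (λ v → eq t (toℕ v · a)))
          (disj (eq y zer) (conj (vp c y) (eq (plus (p · a) u) c)))))

  Sat-digitSplitᶠ : ∀ {m} (η : Vec ℕ m) x a ws →
                    Sat η (digitSplitᶠ x a ws) ⟺ DigitSplit (⟦ η ⟧ x) (⟦ η ⟧ a) (map ⟦ η ⟧ ws)
  Sat-digitSplitᶠ η x a (y ∷ t ∷ z ∷ w ∷ c ∷ u ∷ []) =
    ×-⟺ ⟺-refl (×-⟺ ⟺-refl (×-⟺ digit-part (⊎-⟺ ⟺-refl (×-⟺ ⟺-refl multiple-part))))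
    where
    digit-part : Sat η (⋁ p (λ v → eq t (toℕ v · a))) ⟺ (Σ ℕ λ v → v < p × ⟦ η ⟧ t ≡ v * ⟦ η ⟧ a)
    digit-part =
      (λ s → let (v , t≡) = proj₁ (Sat-⋁ η p (λ v → eq t (toℕ v · a))) s
             in toℕ v , toℕ<n v , trans t≡ (⟦·⟧ η (toℕ v) a)) ,
      (λ (v , v<p , t≡) → proj₂ (Sat-⋁ η p (λ v → eq t (toℕ v · a)))
        (fromℕ< v<p ,
         trans t≡ (trans (cong (_* ⟦ η ⟧ a) (sym (toℕ-fromℕ< v<p))) (sym (⟦·⟧ η (toℕ (fromℕ< v<p)) a)))))
    multiple-part : ⟦ η ⟧ (p · a) + ⟦ η ⟧ u ≡ ⟦ η ⟧ c ⟺ p * ⟦ η ⟧ a + ⟦ η ⟧ u ≡ ⟦ η ⟧ c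
    multiple-part = ≡-⟺ (cong (_+ ⟦ η ⟧ u) (⟦·⟧ η p a)) refl

  DigitSplit⇒digit : ∀ {x a} k ws → a ≡ p ^ k → DigitSplit x a ws → lookup ws (suc zero) ≡ digit x k * a
  DigitSplit⇒digit {x} {a} k (y ∷ t ∷ z ∷ w ∷ c ∷ u ∷ []) a≡ (x≡ , z+w+1≡a , (v , v<p , t≡) , y-multiple) =
    trans t≡ (cong (_* a) (sym digit≡v))
    where
    high : (y ≡ 0 ⊎ (V p c y × p * a + u ≡ c)) → Σ ℕ λ h → y ≡ p ^ suc k * h
    high (inj₁ y≡0) = 0 , trans y≡0 (sym (*-zeroʳ (p ^ suc k)))
    high (inj₂ (y-val , pa+u≡c))
      with V-≥p^⇒p^∣ (suc k) y-val (subst (λ b → p * b ≤ c) a≡ (≤-trans (m≤m+n (p * a) u) (≤-reflexive pa+u≡c)))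
    ... | divides h y≡ = h , trans y≡ (*-comm h (p ^ suc k))
    y-high = high y-multiple
    z<p^k : z < p ^ k
    z<p^k = subst (z <_) (trans (sym (+-assoc z w 1)) (trans z+w+1≡a a≡)) (m<m+n z (subst (0 <_) (+-comm 1 w) (s≤s z≤n)))
    digit≡v : digit x k ≡ v
    digit≡v = trans (cong (λ X → digit X k)
                      (trans x≡ (cong₂ (λ Y T → Y + T + z) (proj₂ y-high) (trans t≡ (cong (v *_) a≡)))))
                (digit-unique k (proj₁ y-high) v z v<p z<p^k)

  digitSplit : ℕ → ℕ → Vec ℕ 6
  digitSplit x k with upper x k ≟ 0
  ... | yes _ = p ^ suc k * upper x k ∷ digit x k * p ^ k ∷ lower x k ∷ p ^ k ∸ suc (lower x k) ∷ 0 ∷ 0 ∷ []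
  ... | no h≢0 = let c = proj₁ (p^*-V-≥p^ (suc k) (upper x k) h≢0) in
    p ^ suc k * upper x k ∷ digit x k * p ^ k ∷ lower x k ∷ p ^ k ∸ suc (lower x k) ∷ c ∷ c ∸ p ^ suc k ∷ []

  lower+gap : ∀ x k → lower x k + (p ^ k ∸ suc (lower x k)) + 1 ≡ p ^ k
  lower+gap x k = trans (+-comm (lower x k + _) 1) (m+[n∸m]≡n (lower<p^k x k))

  digitSplit-valid : ∀ x k → DigitSplit x (p ^ k) (digitSplit x k)
  digitSplit-valid x k with upper x k ≟ 0
  ... | yes h≡0 = digit-decomposition x k , lower+gap x k , (digit x k , digit<p x k , refl) ,
                  inj₁ (trans (cong (p ^ suc k *_) h≡0) (*-zeroʳ (p ^ suc k)))
  ... | no h≢0 = let (c , c-val , p^suc≤c) = p^*-V-≥p^ (suc k) (upper x k) h≢0 in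
                 digit-decomposition x k , lower+gap x k , (digit x k , digit<p x k , refl) ,
                 inj₂ (c-val , m+[n∸m]≡n p^suc≤c)

  digitsAt : ∀ {n} → Vec ℕ n → ℕ → Vec ℕ n
  digitsAt ρ k = map (λ x → digit x k) ρ

  run-suc : ∀ {n} (M : DFA n) k r ρ → run M r ρ (suc k) ≡ δ M (run M r ρ k) (digitsAt ρ k)
  run-suc M zero r ρ = refl
  run-suc M (suc k) r ρ =
    trans (run-suc M k (δ M r (lowDigits ρ)) (highParts ρ))
      (cong (δ M (run M (δ M r (lowDigits ρ)) (highParts ρ) k)) (sym (map-∘ (λ x → digit x k) (_/ p) ρ)))

  indicator : ∀ {S} → Fin S → Fin S → ℕ
  indicator r r′ = if r == r′ then 1 else 0

  indicator<p : ∀ {S} (r r′ : Fin S) → indicator r r′ < p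
  indicator<p r r′ with r == r′
  ... | true = s≤s (s≤s z≤n)
  ... | false = s≤s z≤n

  indicator-refl : ∀ {S} (r : Fin S) → indicator r r ≡ 1
  indicator-refl r rewrite proj₂ (==≡true r r) refl = refl

  indicator≡1⇒≡ : ∀ {S} (r r′ : Fin S) → indicator r r′ ≡ 1 → r ≡ r′
  indicator≡1⇒≡ r r′ h with r == r′ in e
  ... | true = proj₁ (==≡true r r′) e
  ... | false with () <- h

  module RunFormula {n} (M : DFA n) where

    S N #∃ #∀ Ctx : ℕ
    S = states M
    N = (S + S) + n
    #∃ = suc N
    #∀ = suc (suc (N * 6))
    Ctx = #∀ + (#∃ + n)

    -- The existential block is L, X_r, Y_r (r < S), w_i (i < n); the universal block is a, u
    -- and a digit split of each of the N numbers X_r, Y_r, ρ_i.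
    ∀var : Fin #∀ → Term Ctx
    ∀var i = var (i ↑ˡ (#∃ + n))

    ∃var : Fin #∃ → Term Ctx
    ∃var i = var (#∀ ↑ʳ (i ↑ˡ n))

    freeVar : Fin n → Term Ctx
    freeVar i = var (#∀ ↑ʳ (#∃ ↑ʳ i))

    X Y : Fin S → Fin N
    X r = (r ↑ˡ S) ↑ˡ n
    Y r = (S ↑ʳ r) ↑ˡ n

    input : Fin n → Fin N
    input i = (S + S) ↑ʳ i

    number : Fin N → Term Ctx
    number j = [ (λ k → ∃var (suc (k ↑ˡ n))) , freeVar ]′ (splitAt (S + S) j)

    Lᵗ aᵗ uᵗ : Term Ctx
    Lᵗ = ∃var zero
    aᵗ = ∀var zero
    uᵗ = ∀var (suc zero)

    wᵗ : Fin n → Term Ctx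
    wᵗ i = ∃var (suc (input i))

    splitVars : Fin N → Vec (Term Ctx) 6
    splitVars j = tabulate (λ c → ∀var (suc (suc (combine j c))))

    digitᵗ : Fin N → Term Ctx
    digitᵗ j = lookup (splitVars j) (suc zero)

    Shift : Fin S → QF Ctx
    Shift r = eq (number (X r)) (plus (p · number (Y r)) (indicator (start M) r · one))

    Bounded : Fin n → QF Ctx
    Bounded i = eq (plus (plus (number (input i)) (wᵗ i)) one) Lᵗ

    Base : QF Ctx
    Base = conj (vp Lᵗ Lᵗ) (conj (⋀ S Shift) (⋀ n Bounded))

    DigitSplits : QF Ctx
    DigitSplits = ⋀ N (λ j → digitSplitᶠ (number j) aᵗ (splitVars j))

    Position : QF Ctx
    Position = conj (vp aᵗ aᵗ) (conj (eq (plus aᵗ uᵗ) Lᵗ) DigitSplits)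

    DigitsAre : ∀ {m} → (Fin m → Fin N) → (Fin m → ℕ) → QF Ctx
    DigitsAre {m} f v = ⋀ m (λ i → eq (digitᵗ (f i)) (v i · aᵗ))

    InState NextState Accepting : Fin S → QF Ctx
    InState r = DigitsAre X (indicator r)
    NextState r = DigitsAre Y (indicator r)
    Accepting r = if accept M r then ⊤ᶠ else ⊥ᶠ

    Reads : Vec ℕ n → QF Ctx
    Reads c = DigitsAre input (lookup c)

    Transition : Fin S → Vec ℕ n → QF Ctx
    Transition r c = conj (InState r) (Reads c) ⇒ᶠ NextState (δ M r c)

    Final : Fin S → QF Ctx
    Final r = conj (eq uᵗ zer) (InState r) ⇒ᶠ Accepting r

    Checks : QF Ctx
    Checks = conj (⋀ S (λ r → ⋀-digits n (Transition r))) (⋀ S Final)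

    Matrix : QF Ctx
    Matrix = conj Base (Position ⇒ᶠ Checks)

    runFormula : Sig 2 n
    runFormula = ex #∃ (all #∀ (qfS Matrix))

    env : Vec ℕ #∀ → Vec ℕ #∃ → Vec ℕ n → Vec ℕ Ctx
    env ys xs ρ = ys ++ (xs ++ ρ)

    numberValue : Vec ℕ #∃ → Vec ℕ n → Fin N → ℕ
    numberValue xs ρ j = [ (λ k → lookup xs (suc (k ↑ˡ n))) , lookup ρ ]′ (splitAt (S + S) j)

    numberValue-↑ˡ : ∀ xs ρ k → numberValue xs ρ (k ↑ˡ n) ≡ lookup xs (suc (k ↑ˡ n))
    numberValue-↑ˡ xs ρ k = cong [ (λ k → lookup xs (suc (k ↑ˡ n))) , lookup ρ ]′ (splitAt-↑ˡ (S + S) k n)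

    numberValue-input : ∀ xs ρ i → numberValue xs ρ (input i) ≡ lookup ρ i
    numberValue-input xs ρ i = cong [ (λ k → lookup xs (suc (k ↑ˡ n))) , lookup ρ ]′ (splitAt-↑ʳ (S + S) n i)

    module _ (ys : Vec ℕ #∀) (xs : Vec ℕ #∃) (ρ : Vec ℕ n) where

      ⟦∀var⟧ : ∀ i → ⟦ env ys xs ρ ⟧ (∀var i) ≡ lookup ys i
      ⟦∀var⟧ i = lookup-++ˡ ys (xs ++ ρ) i

      ⟦∃var⟧ : ∀ i → ⟦ env ys xs ρ ⟧ (∃var i) ≡ lookup xs i
      ⟦∃var⟧ i = trans (lookup-++ʳ ys (xs ++ ρ) (i ↑ˡ n)) (lookup-++ˡ xs ρ i)

      ⟦number⟧ : ∀ j → ⟦ env ys xs ρ ⟧ (number j) ≡ numberValue xs ρ j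
      ⟦number⟧ j with splitAt (S + S) j
      ... | inj₁ k = ⟦∃var⟧ (suc (k ↑ˡ n))
      ... | inj₂ i = trans (lookup-++ʳ ys (xs ++ ρ) (#∃ ↑ʳ i)) (lookup-++ʳ xs ρ i)

      ⟦splitVars⟧ : ∀ j → map ⟦ env ys xs ρ ⟧ (splitVars j) ≡ tabulate (λ c → lookup ys (suc (suc (combine j c))))
      ⟦splitVars⟧ j = trans (sym (tabulate-∘ ⟦ env ys xs ρ ⟧ (λ c → ∀var (suc (suc (combine j c))))))
                            (tabulate-cong (λ c → ⟦∀var⟧ (suc (suc (combine j c)))))

      Sat-Shift : ∀ r → Sat (env ys xs ρ) (Shift r) ⟺
                  numberValue xs ρ (X r) ≡ indicator (start M) r + p * numberValue xs ρ (Y r)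
      Sat-Shift r = ≡-⟺ (⟦number⟧ (X r))
        (trans (cong₂ _+_ (trans (⟦·⟧ η p (number (Y r))) (cong (p *_) (⟦number⟧ (Y r))))
                          (trans (⟦·⟧ η (indicator (start M) r) one) (*-identityʳ (indicator (start M) r))))
               (+-comm (p * numberValue xs ρ (Y r)) (indicator (start M) r)))
        where
        η = env ys xs ρ

      Sat-Bounded : ∀ i → Sat (env ys xs ρ) (Bounded i) ⟺ lookup ρ i + lookup xs (suc (input i)) + 1 ≡ lookup xs zero
      Sat-Bounded i = ≡-⟺ (cong₂ (λ x w → x + w + 1) (trans (⟦number⟧ (input i)) (numberValue-input xs ρ i))
                                                    (⟦∃var⟧ (suc (input i))))
                          (⟦∃var⟧ zero)

    module AtPosition (ys : Vec ℕ #∀) (xs : Vec ℕ #∃) (ρ : Vec ℕ n) (k : ℕ)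
                      (a≡ : ⟦ env ys xs ρ ⟧ aᵗ ≡ p ^ k)
                      (digit≡ : ∀ j → ⟦ env ys xs ρ ⟧ (digitᵗ j) ≡ digit (numberValue xs ρ j) k * p ^ k) where

      Sat-DigitsAre : ∀ {m} (f : Fin m → Fin N) v →
                      Sat (env ys xs ρ) (DigitsAre f v) ⟺ (∀ i → digit (numberValue xs ρ (f i)) k ≡ v i)
      Sat-DigitsAre {m} f v =
        ⟺-trans (Sat-⋀ (env ys xs ρ) m _) ((λ s i → proj₁ (at i) (s i)) , (λ s i → proj₂ (at i) (s i)))
        where
        at : ∀ i → ⟦ env ys xs ρ ⟧ (digitᵗ (f i)) ≡ ⟦ env ys xs ρ ⟧ (v i · aᵗ) ⟺
                   digit (numberValue xs ρ (f i)) k ≡ v i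
        at i = ⟺-trans (≡-⟺ (digit≡ (f i)) (trans (⟦·⟧ (env ys xs ρ) (v i) aᵗ) (cong (v i *_) a≡)))
                       (cancel-p^ k , cong (_* p ^ k))

    Sat-Accepting : ∀ {m} (η : Vec ℕ m) r → Sat η (if accept M r then ⊤ᶠ else ⊥ᶠ) ⟺ accept M r ≡ true
    Sat-Accepting η r with accept M r
    ... | true = (λ _ → refl) , (λ _ → refl)
    ... | false = (λ s → ⊥-elim (s refl)) , (λ ())

    splitsAt : Vec ℕ #∃ → Vec ℕ n → ℕ → Fin N × Fin 6 → ℕ
    splitsAt xs ρ k (j , c) = lookup (digitSplit (numberValue xs ρ j) k) c

    positionVars : Vec ℕ #∃ → Vec ℕ n → ℕ → ℕ → Vec ℕ #∀
    positionVars xs ρ K k = p ^ k ∷ (p ^ K ∸ p ^ k) ∷ tabulate (λ i → splitsAt xs ρ k (remQuot 6 i))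

    module _ (xs : Vec ℕ #∃) (ρ : Vec ℕ n) (K k : ℕ) where

      ⟦splitVars⟧-position : ∀ j → map ⟦ env (positionVars xs ρ K k) xs ρ ⟧ (splitVars j) ≡
                                   digitSplit (numberValue xs ρ j) k
      ⟦splitVars⟧-position j =
        trans (⟦splitVars⟧ (positionVars xs ρ K k) xs ρ j)
          (trans (tabulate-cong (λ c → trans (lookup∘tabulate (λ i → splitsAt xs ρ k (remQuot 6 i)) (combine j c))
                   (cong (splitsAt xs ρ k) (remQuot-combine j c))))
            (tabulate∘lookup _))

      Sat-digitSplits-position : Sat (env (positionVars xs ρ K k) xs ρ) DigitSplits
      Sat-digitSplits-position = proj₂ (Sat-⋀ _ N _) λ j → proj₂ (Sat-digitSplitᶠ _ (number j) aᵗ (splitVars j)) (valid j)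
        where
        valid : ∀ j → DigitSplit (⟦ env (positionVars xs ρ K k) xs ρ ⟧ (number j)) (p ^ k)
                                 (map ⟦ env (positionVars xs ρ K k) xs ρ ⟧ (splitVars j))
        valid j = subst₂ (λ x ws → DigitSplit x (p ^ k) ws) (sym (⟦number⟧ (positionVars xs ρ K k) xs ρ j))
                    (sym (⟦splitVars⟧-position j)) (digitSplit-valid _ k)

      digitᵗ-position : ∀ j → ⟦ env (positionVars xs ρ K k) xs ρ ⟧ (digitᵗ j) ≡ digit (numberValue xs ρ j) k * p ^ k
      digitᵗ-position j =
        trans (sym (lookup-map (suc zero) ⟦ env (positionVars xs ρ K k) xs ρ ⟧ (splitVars j)))
          (trans (cong (λ ws → lookup ws (suc zero)) (⟦splitVars⟧-position j))
            (DigitSplit⇒digit k _ refl (digitSplit-valid _ k)))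

    module Soundness {R : Vec ℕ n → Set} (rec : Recognises M R) (ρ : Vec ℕ n) (xs : Vec ℕ #∃)
                     (holds : ∀ ys → Sat (env ys xs ρ) Matrix) where

      η₀ : Vec ℕ Ctx
      η₀ = env (zeros #∀) xs ρ

      base : Sat η₀ Base
      base = proj₁ (holds (zeros #∀))

      L-power : Σ ℕ λ K → lookup xs zero ≡ p ^ K
      L-power = V-power (subst₂ (V p) (⟦∃var⟧ (zeros #∀) xs ρ zero) (⟦∃var⟧ (zeros #∀) xs ρ zero) (proj₁ base))

      K : ℕ
      K = proj₁ L-power

      ⟦Lᵗ⟧ : ∀ ys → ⟦ env ys xs ρ ⟧ Lᵗ ≡ p ^ K
      ⟦Lᵗ⟧ ys = trans (⟦∃var⟧ ys xs ρ zero) (proj₂ L-power)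

      X≡ : ∀ r → numberValue xs ρ (X r) ≡ indicator (start M) r + p * numberValue xs ρ (Y r)
      X≡ r = proj₁ (Sat-Shift (zeros #∀) xs ρ r) (proj₁ (Sat-⋀ η₀ S Shift) (proj₁ (proj₂ base)) r)

      ρ<p^K : ρ <ᵥ p ^ K
      ρ<p^K i = subst (lookup ρ i <_) (trans (sym (+-assoc (lookup ρ i) w 1)) (trans bounded (proj₂ L-power)))
                  (m<m+n (lookup ρ i) {w + 1} (subst (0 <_) (+-comm 1 w) (s≤s z≤n)))
        where
        w = lookup xs (suc (input i))
        bounded = proj₁ (Sat-Bounded (zeros #∀) xs ρ i) (proj₁ (Sat-⋀ η₀ n Bounded) (proj₂ (proj₂ base)) i)

      ysₖ : ℕ → Vec ℕ #∀
      ysₖ = positionVars xs ρ K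

      position : ∀ k → k ≤ K → Sat (env (ysₖ k) xs ρ) Position
      position k k≤K =
        subst₂ (V p) (sym (⟦∀var⟧ (ysₖ k) xs ρ zero)) (sym (⟦∀var⟧ (ysₖ k) xs ρ zero)) (V-p^k-p^k k) ,
        trans (cong₂ _+_ (⟦∀var⟧ (ysₖ k) xs ρ zero) (⟦∀var⟧ (ysₖ k) xs ρ (suc zero)))
          (trans (m+[n∸m]≡n (p^-mono-≤ k≤K)) (sym (⟦Lᵗ⟧ (ysₖ k)))) ,
        Sat-digitSplits-position xs ρ K k

      checks : ∀ k → k ≤ K → Sat (env (ysₖ k) xs ρ) Checks
      checks k k≤K = Sat-⇒ᶠ⁻ (env (ysₖ k) xs ρ) {Position} {Checks} (proj₂ (holds (ysₖ k))) (position k k≤K)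

      module At (k : ℕ) = AtPosition (positionVars xs ρ K k) xs ρ k (⟦∀var⟧ (positionVars xs ρ K k) xs ρ zero)
                                     (digitᵗ-position xs ρ K k)

      digitsAt<p : ∀ k → digitsAt ρ k <ᵥ p
      digitsAt<p k i = subst (_< p) (sym (lookup-map i (λ x → digit x k) ρ)) (digit<p _ k)

      Reads-digitsAt : ∀ k → Sat (env (ysₖ k) xs ρ) (Reads (digitsAt ρ k))
      Reads-digitsAt k = proj₂ (At.Sat-DigitsAre k input _)
        (λ i → trans (cong (λ x → digit x k) (numberValue-input xs ρ i)) (sym (lookup-map i (λ x → digit x k) ρ)))

      X-digits : ∀ k → k ≤ K → ∀ r′ → digit (numberValue xs ρ (X r′)) k ≡ indicator (run M (start M) ρ k) r′
      X-digits zero _ r′ =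
        trans (cong (_% p) (X≡ r′)) ([d+p*m]%p≡d _ (numberValue xs ρ (Y r′)) (indicator<p (start M) r′))
      X-digits (suc k) k<K r′ =
        trans (cong (λ x → digit x k)
                (trans (cong (_/ p) (X≡ r′)) ([d+p*m]/p≡m _ (numberValue xs ρ (Y r′)) (indicator<p (start M) r′))))
          (trans (proj₁ (At.Sat-DigitsAre k Y _) next r′) (cong (λ r → indicator r r′) (sym (run-suc M k (start M) ρ))))
        where
        k≤K = ≤-trans (n≤1+n k) k<K
        r = run M (start M) ρ k
        next : Sat (env (ysₖ k) xs ρ) (NextState (δ M r (digitsAt ρ k)))
        next = Sat-⇒ᶠ⁻ _ {conj (InState r) (Reads (digitsAt ρ k))}
                 (proj₁ (Sat-⋀-digits _ n (Transition r)) (proj₁ (Sat-⋀ _ S _) (proj₁ (checks k k≤K)) r)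
                            (digitsAt ρ k) (digitsAt<p k))
                 (proj₂ (At.Sat-DigitsAre k X _) (X-digits k k≤K) , Reads-digitsAt k)

      accepted : accept M (run M (start M) ρ K) ≡ true
      accepted = proj₁ (Sat-Accepting _ r)
        (Sat-⇒ᶠ⁻ _ {conj (eq uᵗ zer) (InState r)} (proj₁ (Sat-⋀ _ S Final) (proj₂ (checks K ≤-refl)) r)
          (trans (⟦∀var⟧ (ysₖ K) xs ρ (suc zero)) (n∸n≡0 (p ^ K)) , proj₂ (At.Sat-DigitsAre K X _) (X-digits K ≤-refl)))
        where
        r = run M (start M) ρ K

      sound : R ρ
      sound = proj₁ (rec K ρ ρ<p^K) accepted

    module Completeness {R : Vec ℕ n → Set} (rec : Recognises M R) (ρ : Vec ℕ n) (Rρ : R ρ) where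

      K : ℕ
      K = sum ρ

      state : ℕ → Fin S
      state k = run M (start M) ρ k

      Xᵛ Yᵛ : Fin S → ℕ
      Xᵛ r = fromDigits (λ k → indicator (state k) r) (suc (suc K))
      Yᵛ r = fromDigits (λ k → indicator (state (suc k)) r) (suc K)

      wᵛ : Fin n → ℕ
      wᵛ i = p ^ K ∸ suc (lookup ρ i)

      xs : Vec ℕ #∃
      xs = p ^ K ∷ (tabulate Xᵛ ++ tabulate Yᵛ) ++ tabulate wᵛ

      X≡ : ∀ r → numberValue xs ρ (X r) ≡ Xᵛ r
      X≡ r = trans (numberValue-↑ˡ xs ρ (r ↑ˡ S))
               (trans (lookup-++ˡ (tabulate Xᵛ ++ tabulate Yᵛ) (tabulate wᵛ) (r ↑ˡ S))
                 (trans (lookup-++ˡ (tabulate Xᵛ) (tabulate Yᵛ) r) (lookup∘tabulate Xᵛ r)))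

      Y≡ : ∀ r → numberValue xs ρ (Y r) ≡ Yᵛ r
      Y≡ r = trans (numberValue-↑ˡ xs ρ (S ↑ʳ r))
               (trans (lookup-++ˡ (tabulate Xᵛ ++ tabulate Yᵛ) (tabulate wᵛ) (S ↑ʳ r))
                 (trans (lookup-++ʳ (tabulate Xᵛ) (tabulate Yᵛ) r) (lookup∘tabulate Yᵛ r)))

      w≡ : ∀ i → lookup xs (suc (input i)) ≡ wᵛ i
      w≡ i = trans (lookup-++ʳ (tabulate Xᵛ ++ tabulate Yᵛ) (tabulate wᵛ) i) (lookup∘tabulate wᵛ i)

      base : ∀ ys → Sat (env ys xs ρ) Base
      base ys =
        subst₂ (V p) (sym (⟦∃var⟧ ys xs ρ zero)) (sym (⟦∃var⟧ ys xs ρ zero)) (V-p^k-p^k K) ,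
        proj₂ (Sat-⋀ (env ys xs ρ) S Shift) (λ r → proj₂ (Sat-Shift ys xs ρ r)
          (trans (X≡ r) (cong (λ y → indicator (start M) r + p * y) (sym (Y≡ r))))) ,
        proj₂ (Sat-⋀ (env ys xs ρ) n Bounded) (λ i → proj₂ (Sat-Bounded ys xs ρ i)
          (trans (cong (λ w → lookup ρ i + w + 1) (w≡ i))
            (trans (+-comm (lookup ρ i + wᵛ i) 1) (m+[n∸m]≡n (<ᵥp^sum ρ i)))))

      module _ (ys : Vec ℕ #∀) (pos : Sat (env ys xs ρ) Position) where

        η : Vec ℕ Ctx
        η = env ys xs ρ

        k : ℕ
        k = proj₁ (V-power (proj₁ pos))

        a≡ : ⟦ η ⟧ aᵗ ≡ p ^ k
        a≡ = proj₂ (V-power (proj₁ pos))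

        a+u≡ : ⟦ η ⟧ aᵗ + ⟦ η ⟧ uᵗ ≡ p ^ K
        a+u≡ = trans (proj₁ (proj₂ pos)) (⟦∃var⟧ ys xs ρ zero)

        k≤K : k ≤ K
        k≤K = p^-cancel-≤ (subst (_≤ p ^ K) a≡ (subst (⟦ η ⟧ aᵗ ≤_) a+u≡ (m≤m+n _ _)))

        digit≡ : ∀ j → ⟦ η ⟧ (digitᵗ j) ≡ digit (numberValue xs ρ j) k * p ^ k
        digit≡ j =
          trans (sym (lookup-map (suc zero) ⟦ η ⟧ (splitVars j)))
            (trans (DigitSplit⇒digit k (map ⟦ η ⟧ (splitVars j)) a≡
                      (proj₁ (Sat-digitSplitᶠ η (number j) aᵗ (splitVars j))
                             (proj₁ (Sat-⋀ η N _) (proj₂ (proj₂ pos)) j)))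
              (cong₂ (λ x a → digit x k * a) (⟦number⟧ ys xs ρ j) a≡))

        open AtPosition ys xs ρ k a≡ digit≡

        X-digit : ∀ r → digit (numberValue xs ρ (X r)) k ≡ indicator (state k) r
        X-digit r = trans (cong (λ x → digit x k) (X≡ r))
                      (digit-fromDigits (λ k → indicator (state k) r) (suc (suc K)) k (λ j → indicator<p (state j) r)
                                        (s≤s (≤-trans k≤K (n≤1+n K))))

        Y-digit : ∀ r → digit (numberValue xs ρ (Y r)) k ≡ indicator (state (suc k)) r
        Y-digit r = trans (cong (λ x → digit x k) (Y≡ r))
                      (digit-fromDigits (λ k → indicator (state (suc k)) r) (suc K) k (λ j → indicator<p (state (suc j)) r)
                                        (s≤s k≤K))

        InState⇒≡ : ∀ r → Sat η (InState r) → state k ≡ r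
        InState⇒≡ r s = indicator≡1⇒≡ (state k) r
                          (trans (sym (X-digit r)) (trans (proj₁ (Sat-DigitsAre X (indicator r)) s r) (indicator-refl r)))

        Reads⇒≡ : ∀ c → Sat η (Reads c) → digitsAt ρ k ≡ c
        Reads⇒≡ c s = lookup-ext λ i → trans (lookup-map i (λ x → digit x k) ρ)
                                    (trans (cong (λ x → digit x k) (sym (numberValue-input xs ρ i)))
                                      (proj₁ (Sat-DigitsAre input (lookup c)) s i))

        transition : ∀ r c → Sat η (Transition r c)
        transition r c = Sat-⇒ᶠ η {conj (InState r) (Reads c)} {NextState (δ M r c)} λ (s , t) →
          proj₂ (Sat-DigitsAre Y (indicator (δ M r c))) λ r′ →
          trans (Y-digit r′) (cong (λ r″ → indicator r″ r′)
            (trans (run-suc M k (start M) ρ) (cong₂ (δ M) (InState⇒≡ r s) (Reads⇒≡ c t))))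

        u≡0⇒k≡K : ⟦ η ⟧ uᵗ ≡ 0 → k ≡ K
        u≡0⇒k≡K u≡0 =
          p^-injective (trans (sym a≡) (trans (sym (+-identityʳ _)) (trans (cong (⟦ η ⟧ aᵗ +_) (sym u≡0)) a+u≡)))

        final : ∀ r → Sat η (Final r)
        final r = Sat-⇒ᶠ η {conj (eq uᵗ zer) (InState r)} {Accepting r} λ (u≡0 , s) → proj₂ (Sat-Accepting η r)
          (subst (λ r′ → accept M r′ ≡ true) (trans (cong state (sym (u≡0⇒k≡K u≡0))) (InState⇒≡ r s))
            (proj₂ (rec K ρ (<ᵥp^sum ρ)) Rρ))

        checks : Sat η Checks
        checks = proj₂ (Sat-⋀ η S _) (λ r → proj₂ (Sat-⋀-digits η n (Transition r)) (λ c _ → transition r c)) ,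
                 proj₂ (Sat-⋀ η S Final) final

      complete : SatS p ρ runFormula
      complete = xs , λ ys → base ys , Sat-⇒ᶠ (env ys xs ρ) {Position} {Checks} (checks ys)

  Automatic⇒Σ₂ : ∀ {n R} → Automatic n R → Σ (Sig 2 n) λ ψ → ∀ ρ → R ρ ⟺ SatS p ρ ψ
  Automatic⇒Σ₂ (M , _ , rec) =
    runFormula , λ ρ → Completeness.complete rec ρ , λ (xs , holds) → Soundness.sound rec ρ xs holds
    where
    open RunFormula M

theorem2 : (p : ℕ) → 2 ≤ p → (i : ℕ) → (φ : Sig i 1) →
    Σ (Sig 2 1) λ ψ → (m : ℕ) → DefSet p φ m ⇔ DefSet p ψ m
theorem2 (suc (suc q)) (s≤s (s≤s z≤n)) i φ =
  let (ψ , same) = Automatic⇒Σ₂ q (Automatic-Sig q φ)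
  in ψ , λ m → mk⇔ (proj₁ (same (m ∷ []))) (proj₂ (same (m ∷ [])))
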